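{- Let $\mathcal{H}=\bigcup_{i\in[t]}\bigcup_{j\in[\ell_i]}P_{i,j}$ be a coarse ear-decomposition in a graph $G$ of girth at least $5$. For each $i\in[t]$ and $j\in[\ell_i]$, if $P_{i,j}$ has length at most $2$, then $j=2$.
   Context: Graphs are finite and simple; $[i]=\{1,\dots,i\}$. For $S\subseteq V(G)$ and $r\ge0$, $B_G(S,r)$ is the set of vertices at distance at most $r$ from $S$ in $G$. $V_{\ge3}(G)$ is the set of vertices of degree at least $3$ in $G$. For a subgraph $H$ of $G$, an $H$-path is a path in $G$ of length at least $1$ whose ends lie in $V(H)$, whose internal vertices are not in $V(H)$, and which shares no edge with $H$. Coarse ear-decomposition: for positive integers $t,\ell_1,\dots,\ell_t$, a subgraph $\mathcal{H}=\bigcup_{i\in[t]}\bigcup_{j\in[\ell_i]}P_{i,j}$ of $G$ such that, with $H_{0,0}$ the null graph, $\ell_0=0$, $Y_{0,0}=Z_{0,0}=\emptyset$, and for $i\in[t],j\in[\ell_i]$: $H_{i,j}=\bigl(\bigcup_{p\in[i-1]}\bigcup_{q\in[\ell_p]}P_{p,q}\bigr)\cup\bigcup_{r\in[j]}P_{i,r}$, $Y_{i,j}=B_{H_{i,j}}(V_{\ge3}(H_{i,j}),2)$, $Z_{i,j}=B_{G-(V(H_{i,j})\setminus Y_{i,j})}(Y_{i,j},1)$, the following hold. (A) For each $i\in[t]$, $G-Z_{i-1,\ell_{i-1}}$ has no $H_{i-1,\ell_{i-1}}$-path. (B) For each $i\in[t]$: if $G-Z_{i-1,\ell_{i-1}}$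 has a cycle meeting $V(H_{i-1,\ell_{i-1}})$ in exactly one vertex, then $P_{i,1}$ is a shortest such cycle (type 1); otherwise $P_{i,1}$ is a shortest cycle of $G-Z_{i-1,\ell_{i-1}}$ (type 2). (C) For each $i\in[t]$ and $j\in[\ell_i]\setminus\{1\}$, $P_{i,j}$ is a shortest $H_{i,j-1}$-path of $G-Z_{i,j-1}$. (The length of a cycle or path is its number of edges.) -}

module Defs where

open import Data.Nat using (ℕ; zero; suc; _≤_; _<_; _∸_)
open import Data.Fin using (Fin)
open import Data.Bool using (Bool; true)
open import Data.List using (List; []; _∷_; _++_; take; length)
open import Data.List.Membership.Propositional using (_∈_)
open import Data.List.Relation.Unary.All using (All)
open import Data.List.Relation.Unary.Unique.Propositional using (Unique)
open import Data.Product using (Σ; ∃; ∃-syntax; _×_; _,_)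
open import Data.Sum using (_⊎_)
open import Data.Empty using (⊥)
open import Data.Unit using (⊤)
open import Relation.Nullary using (¬_)
open import Relation.Binary.PropositionalEquality using (_≡_; _≢_)

record Graph (n : ℕ) : Set where
  field
    adj    : Fin n → Fin n → Bool
    sym    : ∀ x y → adj x y ≡ adj y x
    irrefl : ∀ x → adj x x ≡ true → ⊥

  Adj : Fin n → Fin n → Set
  Adj x y = adj x y ≡ true

open Graph public

record SubG (n : ℕ) : Set₁ where
  field
    V : Fin n → Set
    E : Fin n → Fin n → Set

open SubG public

_─_ : ∀ {n} → Graph n → (Fin n → Set) → SubG n
G ─ X = record { V = λ v → ¬ X v ; E = λ a b → Adj G a b × ¬ X a × ¬ X b }

data Ball {n} (K : SubG n) (S : Fin n → Set) : ℕ → Fin n → Set where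
  here : ∀ {r v} → S v → V K v → Ball K S r v
  step : ∀ {r u v} → Ball K S r u → E K u v → V K v → Ball K S (suc r) v

Deg≥3 : ∀ {n} → SubG n → Fin n → Set
Deg≥3 K v = V K v × (∃[ a ] ∃[ b ] ∃[ c ]
  (a ≢ b × a ≢ c × b ≢ c × E K v a × E K v b × E K v c))

Consec : ∀ {A : Set} → List A → A → A → Set
Consec []           a b = ⊥
Consec (x ∷ [])     a b = ⊥
Consec (x ∷ y ∷ r)  a b = (a ≡ x × b ≡ y) ⊎ Consec (y ∷ r) a b

PathEdge : ∀ {A : Set} → List A → A → A → Set
PathEdge xs a b = Consec xs a b ⊎ Consec xs b a

CycleEdge : ∀ {A : Set} → List A → A → A → Set
CycleEdge xs a b = PathEdge (xs ++ take 1 xs) a b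

IsPath : ∀ {n} → Graph n → (Fin n → Set) → List (Fin n) → Set
IsPath G W xs = 2 ≤ length xs × Unique xs × All W xs
              × (∀ a b → Consec xs a b → Adj G a b)

-- a cycle in the subgraph of G induced by W; its length is length xs
IsCycle : ∀ {n} → Graph n → (Fin n → Set) → List (Fin n) → Set
IsCycle G W xs = 3 ≤ length xs × Unique xs × All W xs
               × (∀ a b → Consec (xs ++ take 1 xs) a b → Adj G a b)

pathLength : ∀ {A : Set} → List A → ℕ
pathLength xs = length xs ∸ 1

cycleLength : ∀ {A : Set} → List A → ℕ
cycleLength xs = length xs

Girth≥5 : ∀ {n} → Graph n → Set
Girth≥5 G = ∀ xs → IsCycle G (λ _ → ⊤) xs → 5 ≤ cycleLength xs

IsHPath : ∀ {n} → Graph n → (Fin n → Set) → SubG n → List (Fin n) → Set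
IsHPath G W H xs = IsPath G W xs ×
  (∃[ a ] ∃[ mid ] ∃[ b ] (xs ≡ a ∷ mid ++ b ∷ [] × V H a × V H b
     × All (λ v → ¬ V H v) mid))
  × (∀ a b → PathEdge xs a b → ¬ E H a b)

MeetsOnce : ∀ {n} → SubG n → List (Fin n) → Set
MeetsOnce H xs = ∃[ v ] (v ∈ xs × V H v × (∀ w → w ∈ xs → V H w → w ≡ v))

-- Coarse ear-decompositions.
-- The ears are P i j (1 ≤ i ≤ t, 1 ≤ j ≤ ℓ i), given as vertex lists:
-- P i 1 is a cycle, P i j (j ≥ 2) is a path.

module Ears {n : ℕ} (G : Graph n) (ℓ : ℕ → ℕ) (P : ℕ → ℕ → List (Fin n)) where

  EarEdge : ℕ → List (Fin n) → Fin n → Fin n → Set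
  EarEdge zero          xs = PathEdge xs
  EarEdge (suc zero)    xs = CycleEdge xs
  EarEdge (suc (suc _)) xs = PathEdge xs

  earLength : ℕ → List (Fin n) → ℕ
  earLength zero          xs = pathLength xs
  earLength (suc zero)    xs = cycleLength xs
  earLength (suc (suc _)) xs = pathLength xs

  Before : ℕ → ℕ → ℕ → ℕ → Set
  Before p q i j = 1 ≤ p × 1 ≤ q × q ≤ ℓ p × (p < i ⊎ (p ≡ i × q ≤ j))

  -- H_{i,j}  (H_{0,j} is the null graph)
  Hs : ℕ → ℕ → SubG n
  Hs i j = record
    { V = λ v → ∃[ p ] ∃[ q ] (Before p q i j × v ∈ P p q)
    ; E = λ a b → ∃[ p ] ∃[ q ] (Before p q i j × EarEdge q (P p q) a b) }

  Y : ℕ → ℕ → Fin n → Set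
  Y i j = Ball (Hs i j) (Deg≥3 (Hs i j)) 2

  Z : ℕ → ℕ → Fin n → Set
  Z i j = Ball (G ─ (λ v → V (Hs i j) v × ¬ Y i j v)) (Y i j) 1

  Outside : ℕ → ℕ → Fin n → Set
  Outside i j v = ¬ Z i j v

  -- condition (A) for i = suc i'
  CondA : ℕ → Set
  CondA i' = ∀ xs → ¬ IsHPath G (Outside i' (ℓ i')) (Hs i' (ℓ i')) xs

  -- condition (B) for i = suc i'
  CondB : ℕ → Set
  CondB i' =
    let W = Outside i' (ℓ i') ; H = Hs i' (ℓ i') ; C = P (suc i') 1 in
    ((∃[ xs ] (IsCycle G W xs × MeetsOnce H xs)) →
        IsCycle G W C × MeetsOnce H C
        × (∀ ys → IsCycle G W ys → MeetsOnce H ys → cycleLength C ≤ cycleLength ys))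
    × (¬ (∃[ xs ] (IsCycle G W xs × MeetsOnce H xs)) →
        IsCycle G W C × (∀ ys → IsCycle G W ys → cycleLength C ≤ cycleLength ys))

  -- condition (C) for i and j = suc j' with j' ≥ 1
  CondC : ℕ → ℕ → Set
  CondC i j' =
    let W = Outside i j' ; H = Hs i j' ; Q = P i (suc j') in
    IsHPath G W H Q × (∀ ys → IsHPath G W H ys → pathLength Q ≤ pathLength ys)

  record CoarseEar (t : ℕ) : Set₁ where
    field
      t-pos : 1 ≤ t
      ℓ-pos : ∀ i → 1 ≤ i → i ≤ t → 1 ≤ ℓ i
      condA : ∀ i' → suc i' ≤ t → CondA i'
      condB : ∀ i' → suc i' ≤ t → CondB i'
      condC : ∀ i j' → 1 ≤ i → i ≤ t → 1 ≤ j' → suc j' ≤ ℓ i → CondC i j'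

{-# OPTIONS --safe #-}
module Submission where

-- A cycle ear P_{i,1} has length at least 5 by the girth assumption.  For j = j₀ + 1 ≥ 3, an ear
-- P_{i,j} of length at most 2 is a short chord: an H_{i,j₀}-path x m y with |m| ≤ 1 in G − Z_{i,j₀}.
-- By induction on q ≤ j₀, no short chord has both ends in H_{i,q}.
-- Since Z only grows along the decomposition, a chord with both ends in H_{i-1,ℓ(i-1)} contradicts (A).
-- If an end x is an inner vertex of the path ear P_{i,q+1} = c … d, then either the chord closes a
-- cycle of length at most 4 with the ear, or it shortcuts the ear, contradicting its minimality (C),
-- or x is at distance at most 2 from c.  But c has degree 3 in H_{i,q+1}, because every vertex of
-- an ear decomposition has two neighbours already; so x ∈ Y ⊆ Z.
-- If x lies on the cycle ear C = P_{i,1}, the chord and C form a theta graph whose two other cycles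
-- contradict the minimality of C in (B) or the girth, except when C has type 2 and the chord ends in
-- H_{i-1,ℓ(i-1)}.  Then C is disjoint from H_{i-1,ℓ(i-1)}, the chord forces P_{i,2} to have length at
-- most 2, and P_{i,2}, an arc of C and the chord give an H_{i-1,ℓ(i-1)}-path or a cycle meeting
-- H_{i-1,ℓ(i-1)} once.

open import Defs hiding (sym)
open import Data.Nat using (ℕ; zero; suc; _≤_; _<_; _+_; z≤n; s≤s; s≤s⁻¹)
open import Data.Nat.Properties
  using (≤-trans; ≤-refl; n≤1+n; <⇒≤; +-suc; +-comm; +-cancelˡ-≤; +-cancelʳ-≤; +-mono-≤; m≤n⇒m<n∨m≡n; m≤n+m; <⇒≱)
open import Data.Fin using (Fin)
open import Data.List using (List; []; _∷_; _++_; take; length; [_])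
open import Data.List.Properties using (++-assoc; ++-identityʳ; length-++; ++-conicalʳ)
open import Data.List.Membership.Propositional using (_∈_; _∉_; lose)
open import Data.List.Membership.Propositional.Properties using (∈-++⁺ˡ; ∈-++⁺ʳ; ∈-++⁻; ∈-∃++)
open import Data.List.Relation.Unary.All as All using (All; []; _∷_)
import Data.List.Relation.Unary.All.Properties as All
open import Data.List.Relation.Unary.Any using (Any; here; there)
open import Data.List.Relation.Unary.AllPairs using ([]; _∷_)
open import Data.List.Relation.Unary.Unique.Propositional using (Unique)
import Data.List.Relation.Unary.Unique.Propositional.Properties as Unique
import Data.List.Relation.Unary.Unique.Setoid.Properties as UniqueSetoid
open import Data.List.Relation.Binary.Disjoint.Propositional using (Disjoint)
open import Data.Product using (∃-syntax; _×_; _,_; proj₁; proj₂)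
import Data.Product as Product
open import Data.Sum using (_⊎_; inj₁; inj₂; [_,_]′)
import Data.Sum as Sum
open import Data.Empty using (⊥; ⊥-elim)
open import Data.Unit using (tt)
open import Function using (_∘_; case_of_)
open import Relation.Nullary using (¬_)
open import Relation.Binary.PropositionalEquality
  using (_≡_; _≢_; refl; sym; trans; cong; subst; subst₂; setoid)

⊥-by-cases : ∀ {P : Set} → (P → ⊥) → (¬ P → ⊥) → ⊥
⊥-by-cases ifP if¬P = if¬P ifP

-- Lists: consecutive pairs, uniqueness, rotation

module _ {A : Set} where

  AllConsec : (A → A → Set) → List A → Set
  AllConsec R xs = ∀ a b → Consec xs a b → R a b

  AllCycleConsec : (A → A → Set) → List A → Set
  AllCycleConsec R xs = AllConsec R (xs ++ take 1 xs)

  Consec-++⁻ : ∀ (xs : List A) y ys {a b} → Consec (xs ++ y ∷ ys) a b →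
               Consec (xs ++ [ y ]) a b ⊎ Consec (y ∷ ys) a b
  Consec-++⁻ []           y ys c        = inj₂ c
  Consec-++⁻ (x ∷ [])     y ys (inj₁ e) = inj₁ (inj₁ e)
  Consec-++⁻ (x ∷ [])     y ys (inj₂ c) = inj₂ c
  Consec-++⁻ (x ∷ x′ ∷ xs) y ys (inj₁ e) = inj₁ (inj₁ e)
  Consec-++⁻ (x ∷ x′ ∷ xs) y ys (inj₂ c) = Sum.map₁ inj₂ (Consec-++⁻ (x′ ∷ xs) y ys c)

  Consec-++⁺ˡ : ∀ (xs : List A) y ys {a b} → Consec (xs ++ [ y ]) a b → Consec (xs ++ y ∷ ys) a b
  Consec-++⁺ˡ (x ∷ [])      y ys (inj₁ e) = inj₁ e
  Consec-++⁺ˡ (x ∷ x′ ∷ xs) y ys (inj₁ e) = inj₁ e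
  Consec-++⁺ˡ (x ∷ x′ ∷ xs) y ys (inj₂ c) = inj₂ (Consec-++⁺ˡ (x′ ∷ xs) y ys c)

  Consec-++⁺ʳ : ∀ (xs : List A) y ys {a b} → Consec (y ∷ ys) a b → Consec (xs ++ y ∷ ys) a b
  Consec-++⁺ʳ []            y ys c = c
  Consec-++⁺ʳ (x ∷ [])      y ys c = inj₂ c
  Consec-++⁺ʳ (x ∷ x′ ∷ xs) y ys c = inj₂ (Consec-++⁺ʳ (x′ ∷ xs) y ys c)

  Consec-∈ : ∀ (xs : List A) {a b} → Consec xs a b → a ∈ xs × b ∈ xs
  Consec-∈ (x ∷ y ∷ xs) (inj₁ (refl , refl)) = here refl , there (here refl)
  Consec-∈ (x ∷ y ∷ xs) (inj₂ c)             = Product.map there there (Consec-∈ (y ∷ xs) c)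

  PathEdge-∈ : ∀ (xs : List A) {a b} → PathEdge xs a b → a ∈ xs × b ∈ xs
  PathEdge-∈ xs (inj₁ c) = Consec-∈ xs c
  PathEdge-∈ xs (inj₂ c) = Product.swap (Consec-∈ xs c)

  Consec-init : ∀ (xs : List A) y {a b} → Consec (xs ++ [ y ]) a b → a ∈ xs
  Consec-init (x ∷ [])      y (inj₁ (refl , _)) = here refl
  Consec-init (x ∷ x′ ∷ xs) y (inj₁ (refl , _)) = here refl
  Consec-init (x ∷ x′ ∷ xs) y (inj₂ c)          = there (Consec-init (x′ ∷ xs) y c)

  Consec-head : ∀ (x : A) xs y → ∃[ h ] (Consec (x ∷ xs ++ [ y ]) x h × h ∈ xs ++ [ y ])
  Consec-head x []       y = y , inj₁ (refl , refl) , here refl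
  Consec-head x (z ∷ xs) y = z , inj₁ (refl , refl) , here refl

  Consec-last : ∀ (x : A) xs y → ∃[ r ] (Consec (x ∷ xs ++ [ y ]) r y × r ∈ x ∷ xs)
  Consec-last x []       y = x , inj₁ (refl , refl) , here refl
  Consec-last x (z ∷ xs) y with Consec-last z xs y
  ... | r , c , r∈ = r , inj₂ c , there r∈

  cycle-unroll : ∀ (x : A) ms y ws → (x ∷ ms ++ y ∷ ws) ++ take 1 (x ∷ ms ++ y ∷ ws) ≡ x ∷ ms ++ y ∷ ws ++ [ x ]
  cycle-unroll x ms y ws = cong (x ∷_) (++-assoc ms (y ∷ ws) [ x ])

  module _ {R : A → A → Set} where

    AllConsec-join : ∀ (xs : List A) y ys → AllConsec R (xs ++ [ y ]) → AllConsec R (y ∷ ys) →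
                     AllConsec R (xs ++ y ∷ ys)
    AllConsec-join xs y ys r₁ r₂ a b c = [ r₁ a b , r₂ a b ]′ (Consec-++⁻ xs y ys c)

    AllConsec-splitˡ : ∀ (xs : List A) y ys → AllConsec R (xs ++ y ∷ ys) → AllConsec R (xs ++ [ y ])
    AllConsec-splitˡ xs y ys r a b c = r a b (Consec-++⁺ˡ xs y ys c)

    AllConsec-splitʳ : ∀ (xs : List A) y ys → AllConsec R (xs ++ y ∷ ys) → AllConsec R (y ∷ ys)
    AllConsec-splitʳ xs y ys r a b c = r a b (Consec-++⁺ʳ xs y ys c)

    AllConsec-pair : ∀ {x y : A} → R x y → AllConsec R (x ∷ [ y ])
    AllConsec-pair r a b (inj₁ (refl , refl)) = r

    AllCycleConsec-split : ∀ (x : A) ms y ws → AllCycleConsec R (x ∷ ms ++ y ∷ ws) →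
                           AllConsec R (x ∷ ms ++ [ y ]) × AllConsec R (y ∷ ws ++ [ x ])
    AllCycleConsec-split x ms y ws r =
      AllConsec-splitˡ (x ∷ ms) y (ws ++ [ x ]) r′ , AllConsec-splitʳ (x ∷ ms) y (ws ++ [ x ]) r′
      where r′ = subst (AllConsec R) (cycle-unroll x ms y ws) r

    AllCycleConsec-join : ∀ (x : A) ms y ws → AllConsec R (x ∷ ms ++ [ y ]) → AllConsec R (y ∷ ws ++ [ x ]) →
                          AllCycleConsec R (x ∷ ms ++ y ∷ ws)
    AllCycleConsec-join x ms y ws r₁ r₂ =
      subst (AllConsec R) (sym (cycle-unroll x ms y ws)) (AllConsec-join (x ∷ ms) y (ws ++ [ x ]) r₁ r₂)

    AllCycleConsec-rotate : ∀ (us : List A) v ws → AllCycleConsec R (us ++ v ∷ ws) → AllCycleConsec R (v ∷ ws ++ us)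
    AllCycleConsec-rotate []       v ws r rewrite ++-identityʳ ws = r
    AllCycleConsec-rotate (u ∷ us) v ws r with AllCycleConsec-split u us v ws r
    ... | r₁ , r₂ = AllCycleConsec-join v ws u us r₂ r₁

  Unique-∷⁻ : ∀ {x : A} {xs} → Unique (x ∷ xs) → x ∉ xs
  Unique-∷⁻ = UniqueSetoid.Unique[x∷xs]⇒x∉xs (setoid A)

  Unique-tail : ∀ {x : A} {xs} → Unique (x ∷ xs) → Unique xs
  Unique-tail (_ ∷ u) = u

  Unique-∷⁺ : ∀ {x : A} {xs} → x ∉ xs → Unique xs → Unique (x ∷ xs)
  Unique-∷⁺ x∉ u = All.tabulate (λ x∈ x≡ → x∉ (subst (_∈ _) (sym x≡) x∈)) ∷ u

  Unique-++⁻ : ∀ (xs : List A) {ys} → Unique (xs ++ ys) → Unique xs × Unique ys × Disjoint xs ys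
  Unique-++⁻ []       u       = [] , u , λ ()
  Unique-++⁻ (x ∷ xs) {ys} u@(_ ∷ u′) with Unique-++⁻ xs u′
  ... | uxs , uys , disj = Unique-∷⁺ (x∉ ∘ ∈-++⁺ˡ) uxs , uys , disj′
    where
    x∉ : x ∉ xs ++ ys
    x∉ = Unique-∷⁻ u
    disj′ : Disjoint (x ∷ xs) ys
    disj′ (here refl , v∈ys) = x∉ (∈-++⁺ʳ xs v∈ys)
    disj′ (there v∈xs , v∈ys) = disj (v∈xs , v∈ys)

  ∈-swap : ∀ (xs ys : List A) {v} → v ∈ xs ++ ys → v ∈ ys ++ xs
  ∈-swap xs ys v∈ = [ ∈-++⁺ʳ ys , ∈-++⁺ˡ ]′ (∈-++⁻ xs v∈)

  Unique-swap : ∀ (xs ys : List A) → Unique (xs ++ ys) → Unique (ys ++ xs)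
  Unique-swap xs ys u with Unique-++⁻ xs u
  ... | uxs , uys , disj = Unique.++⁺ uys uxs (λ (v∈ys , v∈xs) → disj (v∈xs , v∈ys))

  All-swap : ∀ {P : A → Set} (xs ys : List A) → All P (xs ++ ys) → All P (ys ++ xs)
  All-swap xs ys ps with All.++⁻ xs ps
  ... | pxs , pys = All.++⁺ pys pxs

  length-swap : ∀ (xs ys : List A) → length (xs ++ ys) ≡ length (ys ++ xs)
  length-swap xs ys = trans (length-++ xs) (trans (+-comm (length xs) (length ys)) (sym (length-++ ys)))

  module _ {P : A → Set} where

    first-hit : ∀ (xs : List A) → Any P xs →
                ¬ ¬ (∃[ us ] ∃[ w ] ∃[ vs ] (xs ≡ us ++ w ∷ vs × All (¬_ ∘ P) us × P w))
    first-hit (x ∷ xs) (here px)  k = k ([] , x , xs , refl , [] , px)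
    first-hit (x ∷ xs) (there hit) k = ⊥-by-cases
      (λ px → k ([] , x , xs , refl , [] , px))
      (λ ¬px → first-hit xs hit λ (us , w , vs , eq , ¬us , pw) →
         k (x ∷ us , w , vs , cong (x ∷_) eq , ¬px ∷ ¬us , pw))

    last-hit : ∀ (xs : List A) → Any P xs →
               ¬ ¬ (∃[ us ] ∃[ w ] ∃[ vs ] (xs ≡ us ++ w ∷ vs × P w × All (¬_ ∘ P) vs))
    last-hit (x ∷ xs) hit k = ⊥-by-cases
      (λ later → last-hit xs later λ (us , w , vs , eq , pw , ¬vs) →
         k (x ∷ us , w , vs , cong (x ∷_) eq , pw , ¬vs))
      (λ ¬later → k ([] , x , xs , refl , head-hit ¬later hit , All.¬Any⇒All¬ xs ¬later))
      where
      head-hit : ¬ Any P xs → Any P (x ∷ xs) → P x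
      head-hit ¬later (here px)   = px
      head-hit ¬later (there hit′) = ⊥-elim (¬later hit′)

  Neighbours : (A → A → Set) → A → Set
  Neighbours R v = ∃[ u ] ∃[ w ] (u ≢ w × R v u × R v w)

  cycle-neighbours : ∀ {C : List A} {v} → Unique C → 3 ≤ length C → v ∈ C → Neighbours (CycleEdge C) v
  cycle-neighbours {C} {v} uniq 3≤ v∈C with ∈-∃++ v∈C
  ... | us , ws , eq = go (ws ++ us) (subst (3 ≤_) (length-swap us (v ∷ ws)) (subst (λ l → 3 ≤ length l) eq 3≤))
                          (Unique-swap us (v ∷ ws) (subst Unique eq uniq)) edges
    where
    edges : AllCycleConsec (CycleEdge C) (v ∷ ws ++ us)
    edges = AllCycleConsec-rotate us v ws (subst (AllCycleConsec (CycleEdge C)) eq (λ _ _ → inj₁))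
    go : ∀ rest → 3 ≤ length (v ∷ rest) → Unique (v ∷ rest) → AllCycleConsec (CycleEdge C) (v ∷ rest) →
         Neighbours (CycleEdge C) v
    go []             (s≤s ())
    go (_ ∷ [])       (s≤s (s≤s ()))
    go (r₁ ∷ r₂ ∷ rs) _ uniq′ edges′ with Consec-last r₂ rs v
    ... | rₖ , rₖv , rₖ∈ =
      r₁ , rₖ , r₁≢rₖ , proj₁ arcs v r₁ (inj₁ (refl , refl)) , Sum.swap (proj₂ arcs rₖ v (inj₂ rₖv))
      where
      arcs = AllCycleConsec-split v [] r₁ (r₂ ∷ rs) edges′
      r₁≢rₖ : r₁ ≢ rₖ
      r₁≢rₖ refl = Unique-∷⁻ (Unique-tail uniq′) rₖ∈

  interior-neighbours : ∀ (c : A) {rm d v} → Unique (c ∷ rm ++ [ d ]) → v ∈ rm →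
                        Neighbours (PathEdge (c ∷ rm ++ [ d ])) v
  interior-neighbours c {rm} {d} {v} uniq v∈rm with ∈-∃++ v∈rm
  ... | us , ws , refl with Consec-last c us v | Consec-head v ws d
  ... | r , rv , r∈ | h , vh , h∈ = r , h , r≢h , inj₂ (into-leftˡ rv) , inj₁ (into-right vh)
    where
    regroup : c ∷ (us ++ v ∷ ws) ++ [ d ] ≡ (c ∷ us) ++ v ∷ ws ++ [ d ]
    regroup = cong (c ∷_) (++-assoc us (v ∷ ws) [ d ])
    into-leftˡ : Consec (c ∷ us ++ [ v ]) r v → Consec (c ∷ (us ++ v ∷ ws) ++ [ d ]) r v
    into-leftˡ = subst (λ l → Consec l r v) (sym regroup) ∘ Consec-++⁺ˡ (c ∷ us) v (ws ++ [ d ])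
    into-right : Consec (v ∷ ws ++ [ d ]) v h → Consec (c ∷ (us ++ v ∷ ws) ++ [ d ]) v h
    into-right = subst (λ l → Consec l v h) (sym regroup) ∘ Consec-++⁺ʳ (c ∷ us) v (ws ++ [ d ])
    r≢h : r ≢ h
    r≢h refl = proj₂ (proj₂ (Unique-++⁻ (c ∷ us) (subst Unique regroup uniq))) (r∈ , there h∈)

  length-∷++∷ : ∀ (x : A) xs y ys → length (x ∷ xs ++ y ∷ ys) ≡ suc (suc (length xs + length ys))
  length-∷++∷ x xs y ys = cong suc (trans (length-++ xs) (+-suc (length xs) (length ys)))

  middle-shorter : ∀ (pre as bs post : List A) → length (pre ++ as ++ post) ≤ length (pre ++ bs ++ post) →
                   length as ≤ length bs
  middle-shorter pre as bs post ≤′ =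
    +-cancelʳ-≤ (length post) (length as) (length bs)
      (+-cancelˡ-≤ (length pre) _ _ (subst₂ _≤_ (lengths as) (lengths bs) ≤′))
    where
    lengths : ∀ mid → length (pre ++ mid ++ post) ≡ length pre + (length mid + length post)
    lengths mid = trans (length-++ pre) (cong (length pre +_) (length-++ mid))

  nonempty-by : ∀ (as bs : List A) → (as ≡ [] → bs ≡ [] → ⊥) → 1 ≤ length as + length bs
  nonempty-by []      []      both-empty = ⊥-elim (both-empty refl refl)
  nonempty-by []      (_ ∷ _) _          = s≤s z≤n
  nonempty-by (_ ∷ _) _       _          = s≤s z≤n

  snoc-shorter : ∀ {as bs : List A} {a b} → length (as ++ [ a ]) ≤ length (bs ++ [ b ]) → length as ≤ length bs
  snoc-shorter {as} {bs} ≤′ = +-cancelʳ-≤ 1 (length as) (length bs) (subst₂ _≤_ (length-++ as) (length-++ bs) ≤′)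

  ∈-swap-ends : ∀ {a b z} (xs : List A) → z ∈ b ∷ xs ++ [ a ] → z ∈ a ∷ xs ++ [ b ]
  ∈-swap-ends xs (here refl) = there (∈-++⁺ʳ xs (here refl))
  ∈-swap-ends xs (there z∈) with ∈-++⁻ xs z∈
  ... | inj₁ z∈xs        = there (∈-++⁺ˡ z∈xs)
  ... | inj₂ (here refl) = here refl

  AllConsec-middle : ∀ {R : A → A → Set} (pre : List A) x y post → AllConsec R (pre ++ x ∷ y ∷ post) → R x y
  AllConsec-middle pre x y post r = AllConsec-splitʳ pre x (y ∷ post) r x y (inj₁ (refl , refl))

-- Segments and cycles in a graph

∅ᴴ : ∀ {n} → SubG n
∅ᴴ = record { V = λ _ → ⊥ ; E = λ _ _ → ⊥ }

EdgesOnVertices : ∀ {n} → SubG n → Set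
EdgesOnVertices H = ∀ {a b} → E H a b → V H a × V H b

module _ {n : ℕ} (G : Graph n) where

  Adj-sym : ∀ {a b} → Adj G a b → Adj G b a
  Adj-sym {a} {b} = trans (Graph.sym G b a)

  NoEdge : SubG n → Fin n → Fin n → Set
  NoEdge H a b = ¬ E H a b × ¬ E H b a

  record Segment (W : Fin n → Set) (H : SubG n) (u : Fin n) (mid : List (Fin n)) (w : Fin n) : Set where
    field
      adjacent  : AllConsec (Adj G) (u ∷ mid ++ [ w ])
      edges∉H   : AllConsec (NoEdge H) (u ∷ mid ++ [ w ])
      inside    : All W (u ∷ mid ++ [ w ])
      unique    : Unique (u ∷ mid ++ [ w ])
      interior∉H : All (λ v → ¬ V H v) mid

  open Segment public

  Segment-mono : ∀ {W W′ : Fin n → Set} {H H′ : SubG n} {u mid w} →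
                 (∀ {v} → W v → W′ v) → (∀ {v} → V H′ v → V H v) → (∀ {a b} → E H′ a b → E H a b) →
                 Segment W H u mid w → Segment W′ H′ u mid w
  Segment-mono W⊆ VH′⊆ EH′⊆ s = record
    { adjacent   = adjacent s
    ; edges∉H    = λ a b c → Product.map (_∘ EH′⊆) (_∘ EH′⊆) (edges∉H s a b c)
    ; inside     = All.map W⊆ (inside s)
    ; unique     = unique s
    ; interior∉H = All.map (_∘ VH′⊆) (interior∉H s) }

  Segment-forget : ∀ {W : Fin n → Set} {H : SubG n} {u mid w} → Segment W H u mid w → Segment W ∅ᴴ u mid w
  Segment-forget = Segment-mono (λ w → w) (λ ()) (λ ())

  Segment-split : ∀ {W : Fin n → Set} {H : SubG n} {u w} m₁ x m₂ → Segment W H u (m₁ ++ x ∷ m₂) w →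
                  Segment W H u m₁ x × Segment W H x m₂ w × Disjoint (u ∷ m₁) (x ∷ m₂ ++ [ w ])
  Segment-split {W} {u = u} {w} m₁ x m₂ s =
    record { adjacent   = AllConsec-splitˡ (u ∷ m₁) x (m₂ ++ [ w ]) (regroup (adjacent s))
           ; edges∉H    = AllConsec-splitˡ (u ∷ m₁) x (m₂ ++ [ w ]) (regroup (edges∉H s))
           ; inside     = All.++⁻ˡ (u ∷ m₁ ++ [ x ]) (subst (All W) eq′ (inside s))
           ; unique     = proj₁ (Unique-++⁻ (u ∷ m₁ ++ [ x ]) (subst Unique eq′ (unique s)))
           ; interior∉H = All.++⁻ˡ m₁ (interior∉H s) } ,
    record { adjacent   = AllConsec-splitʳ (u ∷ m₁) x (m₂ ++ [ w ]) (regroup (adjacent s))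
           ; edges∉H    = AllConsec-splitʳ (u ∷ m₁) x (m₂ ++ [ w ]) (regroup (edges∉H s))
           ; inside     = All.++⁻ʳ (u ∷ m₁) (subst (All W) eq (inside s))
           ; unique     = proj₁ (proj₂ uniq)
           ; interior∉H = All.++⁻ʳ (x ∷ []) (All.++⁻ʳ m₁ (interior∉H s)) } ,
    proj₂ (proj₂ uniq)
    where
    eq : u ∷ (m₁ ++ x ∷ m₂) ++ [ w ] ≡ (u ∷ m₁) ++ x ∷ m₂ ++ [ w ]
    eq = cong (u ∷_) (++-assoc m₁ (x ∷ m₂) [ w ])
    eq′ : u ∷ (m₁ ++ x ∷ m₂) ++ [ w ] ≡ (u ∷ m₁ ++ [ x ]) ++ m₂ ++ [ w ]
    eq′ = trans eq (cong (u ∷_) (sym (++-assoc m₁ [ x ] (m₂ ++ [ w ]))))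
    regroup : ∀ {R} → AllConsec R (u ∷ (m₁ ++ x ∷ m₂) ++ [ w ]) → AllConsec R ((u ∷ m₁) ++ x ∷ m₂ ++ [ w ])
    regroup {R} = subst (AllConsec R) eq
    uniq = Unique-++⁻ (u ∷ m₁) (subst Unique eq (unique s))

  Segment-join : ∀ {W : Fin n → Set} {H : SubG n} {u m₁ x m₂ w} →
                 Segment W H u m₁ x → Segment W H x m₂ w → ¬ V H x → Disjoint (u ∷ m₁) (m₂ ++ [ w ]) →
                 Segment W H u (m₁ ++ x ∷ m₂) w
  Segment-join {W} {u = u} {m₁} {x} {m₂} {w} s₁ s₂ x∉H disj = record
    { adjacent   = ungroup (AllConsec-join (u ∷ m₁) x (m₂ ++ [ w ]) (adjacent s₁) (adjacent s₂))
    ; edges∉H    = ungroup (AllConsec-join (u ∷ m₁) x (m₂ ++ [ w ]) (edges∉H s₁) (edges∉H s₂))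
    ; inside     = subst (All W) (sym eq) (All.++⁺ (All.++⁻ˡ (u ∷ m₁) (inside s₁)) (inside s₂))
    ; unique     = subst Unique (sym eq) (Unique.++⁺ (proj₁ uniq₁) (unique s₂) disj′)
    ; interior∉H = All.++⁺ (interior∉H s₁) (x∉H ∷ interior∉H s₂) }
    where
    eq : u ∷ (m₁ ++ x ∷ m₂) ++ [ w ] ≡ (u ∷ m₁) ++ x ∷ m₂ ++ [ w ]
    eq = cong (u ∷_) (++-assoc m₁ (x ∷ m₂) [ w ])
    ungroup : ∀ {R} → AllConsec R ((u ∷ m₁) ++ x ∷ m₂ ++ [ w ]) → AllConsec R (u ∷ (m₁ ++ x ∷ m₂) ++ [ w ])
    ungroup {R} = subst (AllConsec R) (sym eq)
    uniq₁ = Unique-++⁻ (u ∷ m₁) (unique s₁)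
    disj′ : Disjoint (u ∷ m₁) (x ∷ m₂ ++ [ w ])
    disj′ (v∈ , here refl) = proj₂ (proj₂ uniq₁) (v∈ , here refl)
    disj′ (v∈ , there v∈′) = disj (v∈ , v∈′)

  Segment-reverse : ∀ {W : Fin n → Set} {H : SubG n} {u m w} → length m ≤ 1 →
                    Segment W H u m w → Segment W H w m u
  Segment-reverse {m = []} _ s = record
    { adjacent   = AllConsec-pair (Adj-sym (adjacent s _ _ (inj₁ (refl , refl))))
    ; edges∉H    = AllConsec-pair (Product.swap (edges∉H s _ _ (inj₁ (refl , refl))))
    ; inside     = u∈W ∷ w∈W ∷ []
    ; unique     = Unique-∷⁺ (λ { (here refl) → u∉ (here refl) }) (Unique-∷⁺ (λ ()) [])
    ; interior∉H = [] }
    where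
    w∈W = All.lookup (inside s) (here refl)
    u∈W = All.lookup (inside s) (there (here refl))
    u∉ = Unique-∷⁻ (unique s)
  Segment-reverse {W} {u = u} {x ∷ []} {w} _ s = record
    { adjacent   = λ { _ _ (inj₁ (refl , refl)) → Adj-sym (adjacent s x w (inj₂ (inj₁ (refl , refl))))
                     ; _ _ (inj₂ (inj₁ (refl , refl))) → Adj-sym (adjacent s u x (inj₁ (refl , refl))) }
    ; edges∉H    = λ { _ _ (inj₁ (refl , refl)) → Product.swap (edges∉H s x w (inj₂ (inj₁ (refl , refl))))
                     ; _ _ (inj₂ (inj₁ (refl , refl))) → Product.swap (edges∉H s u x (inj₁ (refl , refl))) }
    ; inside     = look (there (there (here refl))) ∷ look (there (here refl)) ∷ look (here refl) ∷ []
    ; unique     = Unique-∷⁺ (λ { (here refl) → x∉ (here refl) ; (there (here refl)) → u∉ (there (here refl)) })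
                     (Unique-∷⁺ (λ { (here refl) → u∉ (here refl) }) (Unique-∷⁺ (λ ()) []))
    ; interior∉H = interior∉H s }
    where
    look : ∀ {v} → v ∈ u ∷ x ∷ [ w ] → W v
    look = All.lookup (inside s)
    u∉ = Unique-∷⁻ (unique s)
    x∉ = Unique-∷⁻ (Unique-tail (unique s))
  Segment-reverse {m = _ ∷ _ ∷ _} (s≤s ()) _

  Segment⇒IsHPath : ∀ {W : Fin n → Set} {H : SubG n} {u mid w} → Segment W H u mid w → V H u → V H w →
                    IsHPath G W H (u ∷ mid ++ [ w ])
  Segment⇒IsHPath {u = u} {mid} {w} s u∈H w∈H =
    (2≤ , unique s , inside s , adjacent s) ,
    (_ , mid , w , refl , u∈H , w∈H , interior∉H s) ,
    (λ a b → [ proj₁ ∘ edges∉H s a b , proj₂ ∘ edges∉H s b a ]′)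
    where
    2≤ : 2 ≤ length (u ∷ mid ++ [ w ])
    2≤ = s≤s (subst (1 ≤_) (sym (length-++ mid)) (m≤n+m 1 (length mid)))

  Segment⇒IsCycle : ∀ {W : Fin n → Set} {H : SubG n} {u m₁ w m₂} →
                    Segment W H u m₁ w → Segment W H w m₂ u → Disjoint m₁ m₂ → 1 ≤ length m₁ + length m₂ →
                    IsCycle G W (u ∷ m₁ ++ w ∷ m₂)
  Segment⇒IsCycle {u = u} {m₁} {w} {m₂} s₁ s₂ disj nonempty =
    subst (3 ≤_) (sym (length-∷++∷ u m₁ w m₂)) (s≤s (s≤s nonempty)) ,
    Unique.++⁺ (proj₁ uniq₁) (proj₁ (Unique-++⁻ (w ∷ m₂) (unique s₂))) disj′ ,
    All.++⁺ (All.++⁻ˡ (u ∷ m₁) (inside s₁)) (All.++⁻ˡ (w ∷ m₂) (inside s₂)) ,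
    AllCycleConsec-join u m₁ w m₂ (adjacent s₁) (adjacent s₂)
    where
    uniq₁ = Unique-++⁻ (u ∷ m₁) (unique s₁)
    uniq₂ = Unique-++⁻ (w ∷ m₂) (unique s₂)
    disj′ : Disjoint (u ∷ m₁) (w ∷ m₂)
    disj′ (here refl  , v∈)         = proj₂ (proj₂ uniq₂) (v∈ , here refl)
    disj′ (there v∈   , here refl)  = proj₂ (proj₂ uniq₁) (there v∈ , here refl)
    disj′ (there v∈₁  , there v∈₂)  = disj (v∈₁ , v∈₂)

  IsCycle-mono : ∀ {W W′ : Fin n → Set} {C} → (∀ {v} → W v → W′ v) → IsCycle G W C → IsCycle G W′ C
  IsCycle-mono W⊆ (3≤ , u , inW , adj) = 3≤ , u , All.map W⊆ inW , adj

  IsCycle-rotate : ∀ {W : Fin n → Set} us v ws → IsCycle G W (us ++ v ∷ ws) → IsCycle G W (v ∷ ws ++ us)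
  IsCycle-rotate us v ws (3≤ , u , inW , adj) =
    subst (3 ≤_) (length-swap us (v ∷ ws)) 3≤ ,
    Unique-swap us (v ∷ ws) u , All-swap us (v ∷ ws) inW , AllCycleConsec-rotate us v ws adj

  IsCycle-arcs : ∀ {W : Fin n → Set} x ms y ws → IsCycle G W (x ∷ ms ++ y ∷ ws) →
                 Segment W ∅ᴴ x ms y × Segment W ∅ᴴ y ws x
  IsCycle-arcs {W} x ms y ws (_ , u , inW , adj) =
    record { adjacent = proj₁ arcs ; edges∉H = λ _ _ _ → (λ ()) , (λ ())
           ; inside = All.++⁻ˡ (x ∷ ms ++ [ y ]) (subst (All W) (regroup x ms y ws) inW)
           ; unique = proj₁ (Unique-++⁻ (x ∷ ms ++ [ y ]) (subst Unique (regroup x ms y ws) u))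
           ; interior∉H = All.tabulate λ _ () } ,
    record { adjacent = proj₂ arcs ; edges∉H = λ _ _ _ → (λ ()) , (λ ())
           ; inside = All.++⁻ˡ (y ∷ ws ++ [ x ]) (subst (All W) (regroup y ws x ms) (All-swap (x ∷ ms) (y ∷ ws) inW))
           ; unique = proj₁ (Unique-++⁻ (y ∷ ws ++ [ x ])
                        (subst Unique (regroup y ws x ms) (Unique-swap (x ∷ ms) (y ∷ ws) u)))
           ; interior∉H = All.tabulate λ _ () }
    where
    arcs = AllCycleConsec-split x ms y ws adj
    regroup : ∀ (a : Fin n) as b bs → (a ∷ as) ++ b ∷ bs ≡ (a ∷ as ++ [ b ]) ++ bs
    regroup a as b bs = cong (a ∷_) (sym (++-assoc as [ b ] bs))

  Segment-lift-from-outside : ∀ {W : Fin n → Set} {H : SubG n} {u mid w} → EdgesOnVertices H →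
                              All (λ v → ¬ V H v) (u ∷ mid) → Segment W ∅ᴴ u mid w → Segment W H u mid w
  Segment-lift-from-outside {u = u} {mid} {w} onV outside s = record
    { adjacent   = adjacent s
    ; edges∉H    = λ a b c → let a∉H = All.lookup outside (Consec-init (u ∷ mid) w c)
                             in a∉H ∘ proj₁ ∘ onV , a∉H ∘ proj₂ ∘ onV
    ; inside     = inside s
    ; unique     = unique s
    ; interior∉H = All.tail outside }

  Segment-lift-nonempty : ∀ {W : Fin n → Set} {H : SubG n} {u mid w} → EdgesOnVertices H → mid ≢ [] →
                          All (λ z → ¬ V H z) mid → Segment W ∅ᴴ u mid w → Segment W H u mid w
  Segment-lift-nonempty {mid = []} _ mid≢[] _ _ = ⊥-elim (mid≢[] refl)
  Segment-lift-nonempty {u = u} {v ∷ mid} {w} onV _ outside s = record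
    { adjacent   = adjacent s
    ; edges∉H    = λ { a b (inj₁ (refl , refl)) → v∉H ∘ proj₂ ∘ onV , v∉H ∘ proj₁ ∘ onV
                     ; a b (inj₂ c) → let a∉H = All.lookup outside (Consec-init (v ∷ mid) w c)
                                      in a∉H ∘ proj₁ ∘ onV , a∉H ∘ proj₂ ∘ onV }
    ; inside     = inside s
    ; unique     = unique s
    ; interior∉H = outside }
    where v∉H = All.head outside

  record RotatedCycle (W : Fin n → Set) (C : List (Fin n)) (x : Fin n) : Set where
    field
      rest         : List (Fin n)
      cycle        : IsCycle G W (x ∷ rest)
      to-rotated   : ∀ {v} → v ∈ C → v ∈ x ∷ rest
      from-rotated : ∀ {v} → v ∈ x ∷ rest → v ∈ C
      same-length  : length C ≡ length (x ∷ rest)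
      edges-of-C   : AllCycleConsec (CycleEdge C) (x ∷ rest)

  rotate-at : ∀ {W : Fin n → Set} {C x} → IsCycle G W C → x ∈ C → RotatedCycle W C x
  rotate-at {W} {C} {x} cyc x∈C with ∈-∃++ x∈C
  ... | us , ws , eq = record
    { rest         = ws ++ us
    ; cycle        = IsCycle-rotate us x ws (subst (IsCycle G W) eq cyc)
    ; to-rotated   = λ {v} v∈ → ∈-swap us (x ∷ ws) (subst (v ∈_) eq v∈)
    ; from-rotated = λ {v} v∈ → subst (v ∈_) (sym eq) (∈-swap (x ∷ ws) us v∈)
    ; same-length  = trans (cong length eq) (length-swap us (x ∷ ws))
    ; edges-of-C   = AllCycleConsec-rotate us x ws (subst (AllCycleConsec (CycleEdge C)) eq (λ _ _ → inj₁)) }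

  record Arcs (W : Fin n → Set) (C : List (Fin n)) (x y : Fin n) : Set where
    field
      ms ws      : List (Fin n)
      arc₁       : Segment W ∅ᴴ x ms y
      arc₂       : Segment W ∅ᴴ y ws x
      C-length   : length C ≡ suc (suc (length ms + length ws))
      ∈-arcs     : ∀ {v} → v ∈ C → v ≡ x ⊎ v ≡ y ⊎ v ∈ ms ⊎ v ∈ ws
      arcs-⊆     : ∀ {v} → v ∈ x ∷ ms ++ y ∷ ws → v ∈ C
      arc₁-edge  : ms ≡ [] → CycleEdge C x y
      arc₂-edge  : ws ≡ [] → CycleEdge C x y

  arcs-between : ∀ {W : Fin n → Set} {C x y} → IsCycle G W C → x ∈ C → y ∈ C → x ≢ y → Arcs W C x y
  arcs-between {W} {C} {x} {y} cyc x∈C y∈C x≢y = go (to-rotated y∈C)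
    where
    open RotatedCycle (rotate-at cyc x∈C)
    go : y ∈ x ∷ rest → Arcs W C x y
    go (here y≡x) = ⊥-elim (x≢y (sym y≡x))
    go (there y∈) with ∈-∃++ y∈
    ... | ms , ws , eq = record
      { ms        = ms
      ; ws        = ws
      ; arc₁      = proj₁ arcs
      ; arc₂      = proj₂ arcs
      ; C-length  = trans same-length (trans (cong (length ∘ (x ∷_)) eq) (length-∷++∷ x ms y ws))
      ; ∈-arcs    = λ {v} → locate ∘ subst (v ∈_) (cong (x ∷_) eq) ∘ to-rotated
      ; arcs-⊆    = λ {v} → from-rotated ∘ subst (v ∈_) (cong (x ∷_) (sym eq))
      ; arc₁-edge = λ { refl → proj₁ edges x y (inj₁ (refl , refl)) }
      ; arc₂-edge = λ { refl → Sum.swap (proj₂ edges y x (inj₁ (refl , refl))) } }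
      where
      arcs = IsCycle-arcs x ms y ws (subst (IsCycle G W ∘ (x ∷_)) eq cycle)
      edges = AllCycleConsec-split x ms y ws (subst (AllCycleConsec (CycleEdge C) ∘ (x ∷_)) eq edges-of-C)
      locate : ∀ {v} → v ∈ x ∷ ms ++ y ∷ ws → v ≡ x ⊎ v ≡ y ⊎ v ∈ ms ⊎ v ∈ ws
      locate (here v≡x) = inj₁ v≡x
      locate (there v∈) with ∈-++⁻ ms v∈
      ... | inj₁ v∈ms          = inj₂ (inj₂ (inj₁ v∈ms))
      ... | inj₂ (here v≡y)    = inj₂ (inj₁ v≡y)
      ... | inj₂ (there v∈ws)  = inj₂ (inj₂ (inj₂ v∈ws))

  -- C and a chord x m y between two of its vertices form a theta graph; cycle₁ and cycle₂ are its
  -- two cycles through the chord.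
  record Theta (W : Fin n → Set) (C : List (Fin n)) (x y : Fin n) (m : List (Fin n)) : Set where
    field
      ms ws    : List (Fin n)
      short    : length m ≤ 1
      cycle₁   : IsCycle G W (x ∷ ms ++ y ∷ m)
      cycle₂   : IsCycle G W (y ∷ ws ++ x ∷ m)
      C-length : length C ≡ suc (suc (length ms + length ws))
      ∈-arcs   : ∀ {v} → v ∈ C → v ≡ x ⊎ v ≡ y ⊎ v ∈ ms ⊎ v ∈ ws
      cycle₁-⊆ : ∀ {v} → v ∈ x ∷ ms ++ y ∷ m → v ∈ C ⊎ v ∈ m
      cycle₂-⊆ : ∀ {v} → v ∈ y ∷ ws ++ x ∷ m → v ∈ C ⊎ v ∈ m

  theta : ∀ {W : Fin n → Set} {H : SubG n} {C x y m} → IsCycle G W C → x ∈ C → y ∈ C →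
          length m ≤ 1 → Segment W H x m y → (∀ {v} → v ∈ m → v ∉ C) → (m ≡ [] → ¬ CycleEdge C x y) →
          Theta W C x y m
  theta {C = C} {x} {y} {m} cyc x∈C y∈C short chord m∩C=∅ not-C-edge = record
    { ms       = ms
    ; ws       = ws
    ; short    = short
    ; cycle₁   = Segment⇒IsCycle arc₁ (Segment-reverse short chord′)
                   (λ (v∈ms , v∈m) → m∩C=∅ v∈m (ms⊆C v∈ms)) (nonempty-by ms m λ e₁ e₂ → not-C-edge e₂ (arc₁-edge e₁))
    ; cycle₂   = Segment⇒IsCycle arc₂ chord′
                   (λ (v∈ws , v∈m) → m∩C=∅ v∈m (ws⊆C v∈ws)) (nonempty-by ws m λ e₁ e₂ → not-C-edge e₂ (arc₂-edge e₁))
    ; C-length = C-length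
    ; ∈-arcs   = ∈-arcs
    ; cycle₁-⊆ = on-cycle x∈C ms⊆C y∈C
    ; cycle₂-⊆ = on-cycle y∈C ws⊆C x∈C }
    where
    x≢y : x ≢ y
    x≢y refl = Unique-∷⁻ (unique chord) (∈-++⁺ʳ m (here refl))
    open Arcs (arcs-between cyc x∈C y∈C x≢y)
    chord′ = Segment-forget chord
    ms⊆C : ∀ {v} → v ∈ ms → v ∈ C
    ms⊆C v∈ = arcs-⊆ (there (∈-++⁺ˡ v∈))
    ws⊆C : ∀ {v} → v ∈ ws → v ∈ C
    ws⊆C v∈ = arcs-⊆ (there (∈-++⁺ʳ ms (there v∈)))
    on-cycle : ∀ {a b as} → a ∈ C → (∀ {v} → v ∈ as → v ∈ C) → b ∈ C → ∀ {v} → v ∈ a ∷ as ++ b ∷ m → v ∈ C ⊎ v ∈ m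
    on-cycle {as = as} a∈C as⊆C b∈C (here refl) = inj₁ a∈C
    on-cycle {as = as} a∈C as⊆C b∈C (there v∈) with ∈-++⁻ as v∈
    ... | inj₁ v∈as         = inj₁ (as⊆C v∈as)
    ... | inj₂ (here refl)  = inj₁ b∈C
    ... | inj₂ (there v∈m)  = inj₂ v∈m

  girth≥5 : ∀ {W : Fin n → Set} {C} → Girth≥5 G → IsCycle G W C → 5 ≤ length C
  girth≥5 g5 = g5 _ ∘ IsCycle-mono (λ _ → tt)

  no-short-cycle : ∀ {W : Fin n → Set} {x as y bs} → Girth≥5 G → IsCycle G W (x ∷ as ++ y ∷ bs) →
                   length as ≤ 1 → length bs ≤ 1 → ⊥
  no-short-cycle {x = x} {as} {y} {bs} g5 cyc as≤1 bs≤1 =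
    <⇒≱ (s≤s (s≤s (s≤s (+-mono-≤ as≤1 bs≤1)))) (subst (5 ≤_) (length-∷++∷ x as y bs) (girth≥5 g5 cyc))

  -- If C is no longer than one cycle through the chord, the arc of C that this cycle avoids is no
  -- longer than the chord, so the other cycle through the chord has length at most 4.
  module _ (g5 : Girth≥5 G) {W : Fin n → Set} {C x y m} (θ : Theta W C x y m) where
    open Theta θ

    C≰cycle₁ : ¬ (length C ≤ length (x ∷ ms ++ y ∷ m))
    C≰cycle₁ C≤ = no-short-cycle g5 cycle₂ (≤-trans ws≤m short) short
      where
      ws≤m = +-cancelˡ-≤ (length ms) _ _ (s≤s⁻¹ (s≤s⁻¹ (subst₂ _≤_ C-length (length-∷++∷ x ms y m) C≤)))

    C≰cycle₂ : ¬ (length C ≤ length (y ∷ ws ++ x ∷ m))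
    C≰cycle₂ C≤ = no-short-cycle g5 cycle₁ (≤-trans ms≤m short) short
      where
      C-length′ = trans C-length (cong (suc ∘ suc) (+-comm (length ms) (length ws)))
      ms≤m = +-cancelˡ-≤ (length ws) _ _ (s≤s⁻¹ (s≤s⁻¹ (subst₂ _≤_ C-length′ (length-∷++∷ y ws x m) C≤)))

  -- Walking around the cycle from x, the first and the last vertex of H bound an H-path through x,
  -- unless they coincide.
  cycle-meets-once-or-HPath : ∀ {W : Fin n → Set} {H : SubG n} {C x w} → EdgesOnVertices H →
                              IsCycle G W C → x ∈ C → ¬ V H x → w ∈ C → V H w →
                              ¬ ¬ (MeetsOnce H C ⊎ ∃[ xs ] IsHPath G W H xs)
  cycle-meets-once-or-HPath {W} {H} {C} {x} onV cyc x∈C x∉H w∈C w∈H k = w∈rest (to-rotated w∈C)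
    where
    open RotatedCycle (rotate-at cyc x∈C)
    w∈rest : _ ∈ x ∷ rest → ⊥
    w∈rest (here refl) = x∉H w∈H
    w∈rest (there w∈) = first-hit rest (lose w∈ w∈H) λ (us , w₁ , mid , eq , us∉H , w₁∈H) →
      ⊥-by-cases
        (λ mid-hits → last-hit mid mid-hits λ (m₁ , w₂ , ws , eq′ , w₂∈H , ws∉H) →
           k (inj₂ (_ , Segment⇒IsHPath (around us w₁ mid eq us∉H m₁ w₂ ws eq′ ws∉H) w₂∈H w₁∈H)))
        (λ ¬mid-hits → k (inj₁ (w₁ , from-rotated (there (subst (w₁ ∈_) (sym eq) (∈-++⁺ʳ us (here refl)))) ,
                                w₁∈H , only-w₁ us w₁ mid eq us∉H ¬mid-hits)))
      where
      only-w₁ : ∀ us w₁ mid → rest ≡ us ++ w₁ ∷ mid → All (λ z → ¬ V H z) us → ¬ Any (V H) mid →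
                ∀ z → z ∈ C → V H z → z ≡ w₁
      only-w₁ us w₁ mid eq us∉H ¬mid-hits z z∈C z∈H with to-rotated z∈C
      ... | here refl = ⊥-elim (x∉H z∈H)
      ... | there z∈ with ∈-++⁻ us (subst (z ∈_) eq z∈)
      ... | inj₁ z∈us         = ⊥-elim (All.lookup us∉H z∈us z∈H)
      ... | inj₂ (here z≡w₁)  = z≡w₁
      ... | inj₂ (there z∈mid) = ⊥-elim (¬mid-hits (lose z∈mid z∈H))
      around : ∀ us w₁ mid → rest ≡ us ++ w₁ ∷ mid → All (λ z → ¬ V H z) us →
               ∀ m₁ w₂ ws → mid ≡ m₁ ++ w₂ ∷ ws → All (λ z → ¬ V H z) ws →
               Segment W H w₂ (ws ++ x ∷ us) w₁
      around us w₁ mid eq us∉H m₁ w₂ ws eq′ ws∉H =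
        Segment-lift-nonempty onV (λ e → case ++-conicalʳ ws (x ∷ us) e of λ ()) (All.++⁺ ws∉H (x∉H ∷ us∉H))
          (proj₁ (IsCycle-arcs w₂ (ws ++ x ∷ us) w₁ m₁ rotated))
        where
        L = x ∷ us ++ w₁ ∷ m₁
        split : x ∷ rest ≡ L ++ w₂ ∷ ws
        split = cong (x ∷_) (trans eq (trans (cong (λ r → us ++ w₁ ∷ r) eq′) (sym (++-assoc us (w₁ ∷ m₁) (w₂ ∷ ws)))))
        rotated : IsCycle G W (w₂ ∷ (ws ++ x ∷ us) ++ w₁ ∷ m₁)
        rotated = subst (IsCycle G W ∘ (w₂ ∷_)) (sym (++-assoc ws (x ∷ us) (w₁ ∷ m₁)))
                    (IsCycle-rotate L w₂ ws (subst (IsCycle G W) split cycle))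

-- Stages of a coarse ear-decomposition

Deg≥3-from-new-edge : ∀ {n} {H H′ : SubG n} {v h} → (∀ {a b} → E H a b → E H′ a b) →
                      Neighbours (E H) v → V H′ v → E H′ v h → ¬ E H v h → Deg≥3 H′ v
Deg≥3-from-new-edge E⊆ (u , w , u≢w , vu , vw) v∈H′ vh ¬vh =
  v∈H′ , u , w , _ , u≢w , (λ { refl → ¬vh vu }) , (λ { refl → ¬vh vw }) , E⊆ vu , E⊆ vw , vh

data _≼_ : ℕ × ℕ → ℕ × ℕ → Set where
  earlier : ∀ {p q p′ q′} → p < p′ → (p , q) ≼ (p′ , q′)
  same    : ∀ {p q q′} → q ≤ q′ → (p , q) ≼ (p , q′)

≼-suc : ∀ {p q} → (p , q) ≼ (p , suc q)
≼-suc = same (n≤1+n _)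

module Stages {n : ℕ} (G : Graph n) (ℓ : ℕ → ℕ) (P : ℕ → ℕ → List (Fin n)) where
  open Ears G ℓ P

  VH : ℕ → ℕ → Fin n → Set
  VH p q = V (Hs p q)

  EH : ℕ → ℕ → Fin n → Fin n → Set
  EH p q = E (Hs p q)

  Before-mono : ∀ {x y p q p′ q′} → (p , q) ≼ (p′ , q′) → Before x y p q → Before x y p′ q′
  Before-mono (earlier p<p′) (1≤x , 1≤y , y≤ℓ , inj₁ x<p)          = 1≤x , 1≤y , y≤ℓ , inj₁ (≤-trans x<p (<⇒≤ p<p′))
  Before-mono (earlier p<p′) (1≤x , 1≤y , y≤ℓ , inj₂ (refl , _))   = 1≤x , 1≤y , y≤ℓ , inj₁ p<p′
  Before-mono (same q≤q′)    (1≤x , 1≤y , y≤ℓ , inj₁ x<p)          = 1≤x , 1≤y , y≤ℓ , inj₁ x<p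
  Before-mono (same q≤q′)    (1≤x , 1≤y , y≤ℓ , inj₂ (refl , y≤q)) = 1≤x , 1≤y , y≤ℓ , inj₂ (refl , ≤-trans y≤q q≤q′)

  Before-self : ∀ {p q} → 1 ≤ p → 1 ≤ q → q ≤ ℓ p → Before p q p q
  Before-self 1≤p 1≤q q≤ℓ = 1≤p , 1≤q , q≤ℓ , inj₂ (refl , ≤-refl)

  VH-mono : ∀ {p q p′ q′} → (p , q) ≼ (p′ , q′) → ∀ {v} → VH p q v → VH p′ q′ v
  VH-mono l (x , y , b , v∈) = x , y , Before-mono l b , v∈

  EH-mono : ∀ {p q p′ q′} → (p , q) ≼ (p′ , q′) → ∀ {a b} → EH p q a b → EH p′ q′ a b
  EH-mono l (x , y , b , e) = x , y , Before-mono l b , e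

  EarEdge-sym : ∀ q xs {a b} → EarEdge q xs a b → EarEdge q xs b a
  EarEdge-sym zero          xs = Sum.swap
  EarEdge-sym (suc zero)    xs = Sum.swap
  EarEdge-sym (suc (suc _)) xs = Sum.swap

  EH-sym : ∀ {p q a b} → EH p q a b → EH p q b a
  EH-sym (x , y , b , e) = x , y , b , EarEdge-sym y (P x y) e

  EarEdge-∈ : ∀ q xs {a b} → EarEdge q xs a b → a ∈ xs × b ∈ xs
  EarEdge-∈ zero          xs = PathEdge-∈ xs
  EarEdge-∈ (suc zero)    xs = Product.map (take1⊆ xs) (take1⊆ xs) ∘ PathEdge-∈ (xs ++ take 1 xs)
    where
    take1⊆ : ∀ (xs : List (Fin n)) {v} → v ∈ xs ++ take 1 xs → v ∈ xs
    take1⊆ []       ()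
    take1⊆ (x ∷ xs) v∈ = [ (λ v∈′ → v∈′) , (λ { (here refl) → here refl }) ]′ (∈-++⁻ (x ∷ xs) v∈)
  EarEdge-∈ (suc (suc _)) xs = PathEdge-∈ xs

  EH-onVertices : ∀ {p q} → EdgesOnVertices (Hs p q)
  EH-onVertices (x , y , b , e) =
    (x , y , b , proj₁ (EarEdge-∈ y (P x y) e)) , (x , y , b , proj₂ (EarEdge-∈ y (P x y) e))

  VH-zero : ∀ {q v} → ¬ VH 0 q v
  VH-zero (_ , _ , (1≤x , _ , _ , inj₁ ()) , _)
  VH-zero (_ , _ , (()  , _ , _ , inj₂ (refl , _)) , _)

  VH-suc⁻ : ∀ {p q v} → VH p (suc q) v → VH p q v ⊎ v ∈ P p (suc q)
  VH-suc⁻ (x , y , (1≤x , 1≤y , y≤ℓ , inj₁ x<p) , v∈) = inj₁ (x , y , (1≤x , 1≤y , y≤ℓ , inj₁ x<p) , v∈)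
  VH-suc⁻ (x , y , (1≤x , 1≤y , y≤ℓ , inj₂ (refl , y≤q+1)) , v∈) with m≤n⇒m<n∨m≡n y≤q+1
  ... | inj₁ (s≤s y≤q) = inj₁ (x , y , (1≤x , 1≤y , y≤ℓ , inj₂ (refl , y≤q)) , v∈)
  ... | inj₂ refl      = inj₂ v∈

  VH-first⁻ : ∀ {p v} → VH (suc p) 1 v → VH p (ℓ p) v ⊎ v ∈ P (suc p) 1
  VH-first⁻ (x , y , (1≤x , 1≤y , y≤ℓ , inj₁ (s≤s x≤p)) , v∈) with m≤n⇒m<n∨m≡n x≤p
  ... | inj₁ x<p = inj₁ (x , y , (1≤x , 1≤y , y≤ℓ , inj₁ x<p) , v∈)
  ... | inj₂ refl = inj₁ (x , y , (1≤x , 1≤y , y≤ℓ , inj₂ (refl , y≤ℓ)) , v∈)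
  VH-first⁻ (x , suc zero , (_ , _ , _ , inj₂ (refl , _)) , v∈) = inj₂ v∈
  VH-first⁻ (x , suc (suc _) , (_ , _ , _ , inj₂ (refl , s≤s ())) , _)

  Ball-mono : ∀ {K K′ : SubG n} {S S′ : Fin n → Set} {r v} →
              (∀ {w} → V K w → V K′ w) → (∀ {a b} → E K a b → E K′ a b) → (∀ {w} → S w → S′ w) →
              Ball K S r v → Ball K′ S′ r v
  Ball-mono V⊆ E⊆ S⊆ (here s v∈)   = here (S⊆ s) (V⊆ v∈)
  Ball-mono V⊆ E⊆ S⊆ (step b e v∈) = step (Ball-mono V⊆ E⊆ S⊆ b) (E⊆ e) (V⊆ v∈)

  Deg≥3-mono : ∀ {K K′ : SubG n} {v} → (∀ {w} → V K w → V K′ w) → (∀ {a b} → E K a b → E K′ a b) →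
               Deg≥3 K v → Deg≥3 K′ v
  Deg≥3-mono V⊆ E⊆ (v∈ , a , b , c , a≢b , a≢c , b≢c , ea , eb , ec) =
    V⊆ v∈ , a , b , c , a≢b , a≢c , b≢c , E⊆ ea , E⊆ eb , E⊆ ec

  Deg≥3-stage-mono : ∀ {p q p′ q′} → (p , q) ≼ (p′ , q′) → ∀ {v} → Deg≥3 (Hs p q) v → Deg≥3 (Hs p′ q′) v
  Deg≥3-stage-mono l = Deg≥3-mono (λ {w} → VH-mono l {w}) (λ {a} {b} → EH-mono l {a} {b})

  Y-mono : ∀ {p q p′ q′} → (p , q) ≼ (p′ , q′) → ∀ {v} → Y p q v → Y p′ q′ v
  Y-mono l = Ball-mono (λ {w} → VH-mono l {w}) (λ {a} {b} → EH-mono l {a} {b}) (λ {w} → Deg≥3-stage-mono l {w})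

  Y⊆Z : ∀ {p q v} → Y p q v → Z p q v
  Y⊆Z y = here y (λ (_ , ¬y) → ¬y y)

  -- Z is the 1-ball around Y in G − (V(H) ∖ Y).  As H and Y grow, a vertex can only leave
  -- G − (V(H) ∖ Y) by entering H without entering Y; the hypothesis excludes this for vertices of Z.
  Z-mono : ∀ {p q p′ q′} → (p , q) ≼ (p′ , q′) → (∀ {v} → VH p′ q′ v → ¬ VH p q v → ¬ Z p q v) →
           ∀ {v} → Z p q v → Z p′ q′ v
  Z-mono l new∉Z (here y _) = Y⊆Z (Y-mono l y)
  Z-mono {p} {q} {p′} {q′} l new∉Z {v} z@(step (here yu _) (uv , _ , v∉) _) =
    step (here yu′ u∉) (uv , u∉ , v∉′) v∉′
    where
    yu′ = Y-mono l yu
    u∉ : ¬ (VH p′ q′ _ × ¬ Y p′ q′ _)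
    u∉ (_ , ¬yu) = ¬yu yu′
    v∉′ : ¬ (VH p′ q′ v × ¬ Y p′ q′ v)
    v∉′ (v∈H′ , ¬yv) = ⊥-by-cases (λ v∈H → v∉ (v∈H , ¬yv ∘ Y-mono l)) (λ v∉H → new∉Z v∈H′ v∉H z)

module Decomposition {n : ℕ} (G : Graph n) (t : ℕ) (ℓ : ℕ → ℕ) (P : ℕ → ℕ → List (Fin n))
                     (ce : Ears.CoarseEar G ℓ P t) where
  open Ears G ℓ P
  open CoarseEar ce
  open Stages G ℓ P public

  first-ear-isCycle : ∀ p → suc p ≤ t → ¬ ¬ IsCycle G (Outside p (ℓ p)) (P (suc p) 1)
  first-ear-isCycle p p<t ¬cycle = ⊥-by-cases
    (λ meets  → ¬cycle (proj₁ (proj₁ (condB p p<t) meets)))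
    (λ ¬meets → ¬cycle (proj₁ (proj₂ (condB p p<t) ¬meets)))

  record PathEar (p q : ℕ) (c : Fin n) (rm : List (Fin n)) (d : Fin n) : Set where
    field
      shape       : P p (suc q) ≡ c ∷ rm ++ [ d ]
      segment     : Segment G (Outside p q) (Hs p q) c rm d
      c∈H         : VH p q c
      d∈H         : VH p q d
      shortest    : ∀ ys → IsHPath G (Outside p q) (Hs p q) ys → pathLength (c ∷ rm ++ [ d ]) ≤ pathLength ys
      on-ear      : ∀ {v} → v ∈ c ∷ rm ++ [ d ] → VH p (suc q) v
      edge-of-ear : AllConsec (EH p (suc q)) (c ∷ rm ++ [ d ])

  path-ear : ∀ {p q} → 1 ≤ p → p ≤ t → 1 ≤ q → suc q ≤ ℓ p → ∃[ c ] ∃[ rm ] ∃[ d ] PathEar p q c rm d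
  path-ear {q = zero} _ _ () _
  path-ear {p} {q@(suc _)} 1≤p p≤t 1≤q q<ℓ with condC p q 1≤p p≤t 1≤q q<ℓ
  ... | ((_ , uniq , inW , adj) , (c , rm , d , shape , c∈H , d∈H , rm∉H) , no-edge) , shortest = c , rm , d , record
    { shape = shape
    ; segment = record
        { adjacent   = λ a b → adj a b ∘ on-P
        ; edges∉H    = λ a b ab → no-edge a b (inj₁ (on-P ab)) , no-edge b a (inj₂ (on-P ab))
        ; inside     = subst (All _) shape inW
        ; unique     = subst Unique shape uniq
        ; interior∉H = rm∉H }
    ; c∈H = c∈H ; d∈H = d∈H
    ; shortest = λ ys → subst (λ xs → pathLength xs ≤ pathLength ys) shape ∘ shortest ys
    ; on-ear = λ {v} v∈ → p , suc q , self , subst (v ∈_) (sym shape) v∈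
    ; edge-of-ear = λ a b ab → p , suc q , self , inj₁ (on-P ab) }
    where
    self = Before-self 1≤p (s≤s z≤n) q<ℓ
    on-P : ∀ {a b} → Consec (c ∷ rm ++ [ d ]) a b → Consec (P p (suc q)) a b
    on-P {a} {b} = subst (λ xs → Consec xs a b) (sym shape)

  Z-step-path : ∀ {p q} → 1 ≤ p → p ≤ t → 1 ≤ q → suc q ≤ ℓ p → ∀ {v} → Z p q v → Z p (suc q) v
  Z-step-path {p} {q} 1≤p p≤t 1≤q q<ℓ with path-ear 1≤p p≤t 1≤q q<ℓ
  ... | _ , _ , _ , ear = Z-mono ≼-suc new∉Z
    where
    open PathEar ear
    new∉Z : ∀ {v} → VH p (suc q) v → ¬ VH p q v → ¬ Z p q v
    new∉Z {v} v∈H′ v∉H z = [ v∉H , (λ v∈P → All.lookup (inside segment) (subst (v ∈_) shape v∈P) z) ]′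
                             (VH-suc⁻ v∈H′)

  Z-step-cycle : ∀ {p} → suc p ≤ t → ∀ {v} → Z p (ℓ p) v → Z (suc p) 1 v
  Z-step-cycle {p} p<t = Z-mono (earlier ≤-refl) new∉Z
    where
    new∉Z : ∀ {v} → VH (suc p) 1 v → ¬ VH p (ℓ p) v → ¬ Z p (ℓ p) v
    new∉Z v∈H′ v∉H z = [ v∉H , (λ v∈C → first-ear-isCycle p p<t λ (_ , _ , inW , _) → All.lookup inW v∈C z) ]′
                         (VH-first⁻ v∈H′)

  Z-up : ∀ {p q q′} → 1 ≤ p → p ≤ t → 1 ≤ q → q ≤ q′ → q′ ≤ ℓ p → ∀ {v} → Z p q v → Z p q′ v
  Z-up {q′ = zero}   1≤p p≤t (s≤s _) () _
  Z-up {q = q} {suc q′} 1≤p p≤t 1≤q q≤q′+1 q′<ℓ z with m≤n⇒m<n∨m≡n q≤q′+1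
  ... | inj₂ refl      = z
  ... | inj₁ (s≤s q≤q′) =
    Z-step-path 1≤p p≤t (≤-trans 1≤q q≤q′) q′<ℓ (Z-up 1≤p p≤t 1≤q q≤q′ (≤-trans (n≤1+n q′) q′<ℓ) z)

  ear-interior : ∀ {p q c rm d v} → PathEar p q c rm d → ¬ VH p q v → VH p (suc q) v → v ∈ rm
  ear-interior {rm = rm} {v = v} ear v∉H v∈H′ with VH-suc⁻ v∈H′
  ... | inj₁ v∈H = ⊥-elim (v∉H v∈H)
  ... | inj₂ v∈P with subst (v ∈_) (PathEar.shape ear) v∈P
  ...   | here refl = ⊥-elim (v∉H (PathEar.c∈H ear))
  ...   | there v∈ with ∈-++⁻ rm v∈
  ...     | inj₁ v∈rm        = v∈rm
  ...     | inj₂ (here refl) = ⊥-elim (v∉H (PathEar.d∈H ear))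

  Neighbours-mono : ∀ {p q p′ q′} → (p , q) ≼ (p′ , q′) → ∀ {v} → Neighbours (EH p q) v → Neighbours (EH p′ q′) v
  Neighbours-mono l (u , w , u≢w , vu , vw) = u , w , u≢w , EH-mono l vu , EH-mono l vw

  first-ear-neighbours : ∀ p → suc p ≤ t → ∀ {v} → v ∈ P (suc p) 1 → ¬ ¬ Neighbours (EH (suc p) 1) v
  first-ear-neighbours p p<t v∈C k = first-ear-isCycle p p<t λ (3≤ , uniq , _ , _) →
    let (u , w , u≢w , vu , vw) = cycle-neighbours uniq 3≤ v∈C in k (u , w , u≢w , on-C vu , on-C vw)
    where
    on-C : ∀ {a b} → CycleEdge (P (suc p) 1) a b → EH (suc p) 1 a b
    on-C e = suc p , 1 , Before-self (s≤s z≤n) ≤-refl (ℓ-pos (suc p) (s≤s z≤n) p<t) , e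

  MinDegree2 : ℕ → ℕ → Set
  MinDegree2 p q = ∀ {v} → VH p q v → ¬ ¬ Neighbours (EH p q) v

  MinDegree2-first : ∀ {p} → suc p ≤ t → MinDegree2 p (ℓ p) → MinDegree2 (suc p) 1
  MinDegree2-first {p} p<t previous v∈ =
    [ (λ v∈H k → previous v∈H (k ∘ Neighbours-mono (earlier ≤-refl))) , first-ear-neighbours p p<t ]′ (VH-first⁻ v∈)

  MinDegree2-suc : ∀ {p q} → 1 ≤ p → p ≤ t → 1 ≤ q → suc q ≤ ℓ p → MinDegree2 p q → MinDegree2 p (suc q)
  MinDegree2-suc {p} {q} 1≤p p≤t 1≤q q<ℓ previous {v} v∈ k with path-ear 1≤p p≤t 1≤q q<ℓ
  ... | c , rm , d , ear = [ from-previous , on-new-ear ∘ subst (v ∈_) shape ]′ (VH-suc⁻ v∈)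
    where
    open PathEar ear
    from-previous : VH p q v → ⊥
    from-previous v∈H = previous v∈H (k ∘ Neighbours-mono ≼-suc)
    on-ear′ : ∀ {a b} → PathEdge (c ∷ rm ++ [ d ]) a b → EH p (suc q) a b
    on-ear′ (inj₁ ab) = edge-of-ear _ _ ab
    on-ear′ (inj₂ ba) = EH-sym (edge-of-ear _ _ ba)
    on-new-ear : v ∈ c ∷ rm ++ [ d ] → ⊥
    on-new-ear (here refl) = from-previous c∈H
    on-new-ear (there v∈′) with ∈-++⁻ rm v∈′
    ... | inj₂ (here refl) = from-previous d∈H
    ... | inj₁ v∈rm = let (u , w , u≢w , vu , vw) = interior-neighbours c (unique segment) v∈rm
                      in k (u , w , u≢w , on-ear′ vu , on-ear′ vw)

  min-degree-2 : ∀ p q → p ≤ t → 1 ≤ q → q ≤ ℓ p → MinDegree2 p q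
  min-degree-2 zero          q             _   _ _   v∈ = ⊥-elim (VH-zero v∈)
  min-degree-2 (suc zero)    (suc zero)    p<t _ _      = MinDegree2-first p<t (⊥-elim ∘ VH-zero)
  min-degree-2 (suc (suc p)) (suc zero)    p<t _ _      =
    MinDegree2-first p<t (min-degree-2 (suc p) (ℓ (suc p)) p≤t (ℓ-pos (suc p) (s≤s z≤n) p≤t) ≤-refl)
    where p≤t = ≤-trans (n≤1+n _) p<t
  min-degree-2 (suc p)       (suc (suc q)) p≤t _ q<ℓ    =
    MinDegree2-suc (s≤s z≤n) p≤t (s≤s z≤n) q<ℓ (min-degree-2 (suc p) (suc q) p≤t (s≤s z≤n) (≤-trans (n≤1+n _) q<ℓ))

  path-ear-ends-Deg≥3 : ∀ {p q c rm d} → p ≤ t → 1 ≤ q → suc q ≤ ℓ p → PathEar p q c rm d →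
                        ¬ ¬ (Deg≥3 (Hs p (suc q)) c × Deg≥3 (Hs p (suc q)) d)
  path-ear-ends-Deg≥3 {p} {q} {c} {rm} {d} p≤t 1≤q q<ℓ ear k =
    min-degree-2 p q p≤t 1≤q q≤ℓ c∈H λ c-nbrs →
    min-degree-2 p q p≤t 1≤q q≤ℓ d∈H λ d-nbrs →
    k ( third-neighbour c-nbrs (on-ear (here refl)) (edge-of-ear _ _ ch) (proj₁ (edges∉H segment _ _ ch))
      , third-neighbour d-nbrs (on-ear (there (∈-++⁺ʳ rm (here refl))))
          (EH-sym (edge-of-ear _ _ rd)) (proj₂ (edges∉H segment _ _ rd)) )
    where
    open PathEar ear
    q≤ℓ = ≤-trans (n≤1+n q) q<ℓ
    third-neighbour : ∀ {v h} → Neighbours (EH p q) v → VH p (suc q) v → EH p (suc q) v h → ¬ EH p q v h →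
                      Deg≥3 (Hs p (suc q)) v
    third-neighbour = Deg≥3-from-new-edge {H = Hs p q} {H′ = Hs p (suc q)} (λ {a} {b} → EH-mono ≼-suc {a} {b})
    ch = proj₁ (proj₂ (Consec-head c rm d))
    rd = proj₁ (proj₂ (Consec-last c rm d))

-- Short chords

-- i = i′ + 1 and j₀ ≥ 2; a short ear P i (j₀ + 1) would be a ShortChord.  In names, H′ stands for
-- H_{i′,ℓ i′}, H₁ for H_{i,1} and B for H_{i,j₀}.
module ShortChords {n : ℕ} (G : Graph n) (g5 : Girth≥5 G) (t : ℕ) (ℓ : ℕ → ℕ) (P : ℕ → ℕ → List (Fin n))
                   (ce : Ears.CoarseEar G ℓ P t) (i′ j₀ : ℕ) (i≤t : suc i′ ≤ t) (2≤j₀ : 2 ≤ j₀)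
                   (j₀<ℓ : suc j₀ ≤ ℓ (suc i′)) where
  open Ears G ℓ P
  open CoarseEar ce
  open Decomposition G t ℓ P ce

  i : ℕ
  i = suc i′

  1≤j₀ : 1 ≤ j₀
  1≤j₀ = ≤-trans (s≤s z≤n) 2≤j₀

  j₀≤ℓ : j₀ ≤ ℓ i
  j₀≤ℓ = ≤-trans (n≤1+n j₀) j₀<ℓ

  ShortChord : Fin n → List (Fin n) → Fin n → Set
  ShortChord x m y = length m ≤ 1 × Segment G (Outside i j₀) (Hs i j₀) x m y

  ShortChord-reverse : ∀ {x m y} → ShortChord x m y → ShortChord y m x
  ShortChord-reverse (short , chord) = short , Segment-reverse G short chord

  chord-interior : ∀ {x m y v} → ShortChord x m y → v ∈ m → ¬ VH i j₀ v
  chord-interior (_ , chord) = All.lookup (interior∉H chord)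

  chord-edge : ∀ {x y} → ShortChord x [] y → ¬ EH i j₀ x y
  chord-edge (_ , chord) = proj₁ (edges∉H chord _ _ (inj₁ (refl , refl)))

  chord-start∉Z : ∀ {x m y} → ShortChord x m y → ¬ Z i j₀ x
  chord-start∉Z (_ , chord) = All.lookup (inside chord) (here refl)

  chord-end∉Z : ∀ {x m y} → ShortChord x m y → ¬ Z i j₀ y
  chord-end∉Z {m = m} (_ , chord) = All.lookup (inside chord) (there (∈-++⁺ʳ m (here refl)))

  chord-ends-distinct : ∀ {x m y} → ShortChord x m y → x ≢ y
  chord-ends-distinct {m = m} (_ , chord) refl = Unique-∷⁻ (unique chord) (∈-++⁺ʳ m (here refl))

  chord-at : ∀ {q x m y} → 1 ≤ q → q ≤ j₀ → ShortChord x m y → Segment G (Outside i q) (Hs i q) x m y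
  chord-at 1≤q q≤j₀ (_ , chord) =
    Segment-mono G (λ ∉Z → ∉Z ∘ Z-up (s≤s z≤n) i≤t 1≤q q≤j₀ j₀≤ℓ) (VH-mono (same q≤j₀)) (EH-mono (same q≤j₀)) chord

  NoChord : ℕ → Set
  NoChord q = ∀ {x m y} → ShortChord x m y → VH i q x → VH i q y → ⊥

  module PathStage {q} (1≤q : 1 ≤ q) (q<j₀ : suc q ≤ j₀) where
    q<ℓ : suc q ≤ ℓ i
    q<ℓ = ≤-trans q<j₀ j₀≤ℓ

    Deg≥3⇒Z : ∀ {v} → Deg≥3 (Hs i (suc q)) v → Z i j₀ v
    Deg≥3⇒Z v-deg = Y⊆Z (here v-deg′ (proj₁ v-deg′))
      where v-deg′ = Deg≥3-stage-mono (same q<j₀) v-deg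

    near-end-in-Y : ∀ {c us x ws d} → PathEar i q c (us ++ x ∷ ws) d → length us ≤ 1 →
                    Deg≥3 (Hs i (suc q)) c → Y i j₀ x
    near-end-in-Y {us = []} ear _ c-deg =
      step (here c-deg′ (proj₁ c-deg′)) (EH-mono (same q<j₀) (edge-of-ear _ _ (inj₁ (refl , refl))))
        (VH-mono (same q<j₀) (on-ear (there (here refl))))
      where
      open PathEar ear
      c-deg′ = Deg≥3-stage-mono (same q<j₀) c-deg
    near-end-in-Y {us = _ ∷ []} ear _ c-deg =
      step (step (here c-deg′ (proj₁ c-deg′)) (EH-mono (same q<j₀) (edge-of-ear _ _ (inj₁ (refl , refl))))
                 (VH-mono (same q<j₀) (on-ear (there (here refl)))))
           (EH-mono (same q<j₀) (edge-of-ear _ _ (inj₂ (inj₁ (refl , refl)))))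
           (VH-mono (same q<j₀) (on-ear (there (there (here refl)))))
      where
      open PathEar ear
      c-deg′ = Deg≥3-stage-mono (same q<j₀) c-deg
    near-end-in-Y {us = _ ∷ _ ∷ _} _ (s≤s ()) _

    -- If x were at distance at least 3 from c along the ear, y m x … d would be a shorter H_{i,q}-path;
    -- so x is near the degree-3 end c and lies in Y.
    chord-from-ear-to-old : ∀ {c us x ws d m y} → PathEar i q c (us ++ x ∷ ws) d → ShortChord x m y → VH i q y → ⊥
    chord-from-ear-to-old {us = us} {x} {ws} {d} {m} {y} ear sc@(short , _) y∈H =
      path-ear-ends-Deg≥3 i≤t 1≤q q<ℓ ear λ (c-deg , d-deg) →
      chord-start∉Z sc (Y⊆Z (near-end-in-Y ear (≤-trans (us≤m (y≢d d-deg)) short) c-deg))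
      where
      open PathEar ear
      x∉H : ¬ VH i q x
      x∉H = All.lookup (interior∉H segment) (∈-++⁺ʳ us (here refl))
      y≢d : Deg≥3 (Hs i (suc q)) d → y ≢ d
      y≢d d-deg refl = chord-end∉Z sc (Deg≥3⇒Z d-deg)
      x-to-d = proj₁ (proj₂ (Segment-split G us x ws segment))
      disjoint : y ≢ d → Disjoint (y ∷ m) (ws ++ [ d ])
      disjoint y≢d (here refl , v∈) with ∈-++⁻ ws v∈
      ... | inj₁ y∈ws        = All.lookup (interior∉H x-to-d) y∈ws y∈H
      ... | inj₂ (here refl) = y≢d refl
      disjoint y≢d (there v∈m , v∈) =
        chord-interior sc v∈m (VH-mono (same q<j₀) (on-ear
          (there (subst (_ ∈_) (sym (++-assoc us (x ∷ ws) [ d ])) (∈-++⁺ʳ us (there v∈))))))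
      detour : y ≢ d → Segment G (Outside i q) (Hs i q) y (m ++ x ∷ ws) d
      detour y≢d = Segment-join G (Segment-reverse G short (chord-at 1≤q (<⇒≤ q<j₀) sc)) x-to-d x∉H (disjoint y≢d)
      us≤m : y ≢ d → length us ≤ length m
      us≤m y≢d = middle-shorter [] us m (x ∷ ws ++ [ d ])
        (subst₂ _≤_ (cong length (++-assoc us (x ∷ ws) [ d ])) (cong length (++-assoc m (x ∷ ws) [ d ]))
          (shortest _ (Segment⇒IsHPath G (detour y≢d) y∈H d∈H)))

    module AlongEar {c us x ms y ws d m} (ear : PathEar i q c (us ++ x ∷ ms ++ y ∷ ws) d) (sc : ShortChord x m y)
      where
      open PathEar ear

      chord′ : Segment G (Outside i q) (Hs i q) x m y
      chord′ = chord-at 1≤q (<⇒≤ q<j₀) sc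

      split₁ : Segment G (Outside i q) (Hs i q) c us x × Segment G (Outside i q) (Hs i q) x (ms ++ y ∷ ws) d ×
               Disjoint (c ∷ us) (x ∷ (ms ++ y ∷ ws) ++ [ d ])
      split₁ = Segment-split G us x (ms ++ y ∷ ws) segment

      split₂ : Segment G (Outside i q) (Hs i q) x ms y × Segment G (Outside i q) (Hs i q) y ws d ×
               Disjoint (x ∷ ms) (y ∷ ws ++ [ d ])
      split₂ = Segment-split G ms y ws (proj₁ (proj₂ split₁))

      regroup′ : (us ++ x ∷ ms ++ y ∷ ws) ++ [ d ] ≡ us ++ x ∷ ms ++ y ∷ ws ++ [ d ]
      regroup′ = trans (++-assoc us _ [ d ]) (cong (λ r → us ++ x ∷ r) (++-assoc ms (y ∷ ws) [ d ]))

      regroup : c ∷ (us ++ x ∷ ms ++ y ∷ ws) ++ [ d ] ≡ (c ∷ us) ++ x ∷ ms ++ y ∷ ws ++ [ d ]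
      regroup = cong (c ∷_) regroup′

      on-B : ∀ {v} → v ∈ (c ∷ us) ++ x ∷ ms ++ y ∷ ws ++ [ d ] → VH i j₀ v
      on-B {v} = VH-mono (same q<j₀) ∘ on-ear ∘ subst (v ∈_) (sym regroup)

      from-x : ∀ {v} → v ∈ x ∷ ms ++ y ∷ ws ++ [ d ] → VH i j₀ v
      from-x = on-B ∘ ∈-++⁺ʳ (c ∷ us)

      shortcut : Segment G (Outside i q) (Hs i q) c ((us ++ x ∷ m) ++ y ∷ ws) d
      shortcut = Segment-join G (Segment-join G (proj₁ split₁) chord′ x∉H disj₁) (proj₁ (proj₂ split₂)) y∉H disj₂
        where
        x∉H : ¬ VH i q x
        x∉H = All.lookup (interior∉H segment) (∈-++⁺ʳ us (here refl))
        y∉H : ¬ VH i q y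
        y∉H = All.lookup (interior∉H (proj₁ (proj₂ split₁))) (∈-++⁺ʳ ms (here refl))
        after-y : ∀ {v} → v ∈ ws ++ [ d ] → v ∈ x ∷ ms ++ y ∷ ws ++ [ d ]
        after-y = there ∘ ∈-++⁺ʳ ms ∘ there
        regroup-x : ∀ {v} → v ∈ x ∷ ms ++ y ∷ ws ++ [ d ] → v ∈ x ∷ (ms ++ y ∷ ws) ++ [ d ]
        regroup-x {v} = subst (v ∈_) (cong (x ∷_) (sym (++-assoc ms (y ∷ ws) [ d ])))
        disj₁ : Disjoint (c ∷ us) (m ++ [ y ])
        disj₁ (v∈ , v∈′) with ∈-++⁻ m v∈′
        ... | inj₁ v∈m         = chord-interior sc v∈m (on-B (∈-++⁺ˡ v∈))
        ... | inj₂ (here refl) = proj₂ (proj₂ split₁) (v∈ , regroup-x (there (∈-++⁺ʳ ms (here refl))))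
        disj₂ : Disjoint ((c ∷ us) ++ x ∷ m) (ws ++ [ d ])
        disj₂ (v∈ , v∈′) with ∈-++⁻ (c ∷ us) v∈
        ... | inj₁ v∈cus       = proj₂ (proj₂ split₁) (v∈cus , regroup-x (after-y v∈′))
        ... | inj₂ (here refl) = proj₂ (proj₂ split₂) (here refl , there v∈′)
        ... | inj₂ (there v∈m) = chord-interior sc v∈m (from-x (after-y v∈′))

      ms≤m : length ms ≤ length m
      ms≤m = s≤s⁻¹ (middle-shorter us (x ∷ ms) (x ∷ m) (y ∷ ws ++ [ d ])
        (subst₂ _≤_ (cong length regroup′)
                    (cong length (trans (++-assoc (us ++ x ∷ m) (y ∷ ws) [ d ])
                                        (++-assoc us (x ∷ m) (y ∷ ws ++ [ d ]))))
                    (shortest _ (Segment⇒IsHPath G shortcut c∈H d∈H))))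

      not-both-empty : ms ≡ [] → m ≡ [] → ⊥
      not-both-empty ms≡[] m≡[] =
        chord-edge (subst (λ m′ → ShortChord x m′ y) m≡[] sc) (EH-mono (same q<j₀) (AllConsec-middle (c ∷ us) x y (ws ++ [ d ])
          (subst (λ ms′ → AllConsec (EH i (suc q)) ((c ∷ us) ++ x ∷ ms′ ++ y ∷ ws ++ [ d ])) ms≡[]
                 (subst (AllConsec (EH i (suc q))) regroup edge-of-ear))))

      cycle : IsCycle G (Outside i q) (x ∷ ms ++ y ∷ m)
      cycle = Segment⇒IsCycle G (proj₁ split₂) (Segment-reverse G (proj₁ sc) chord′)
                (λ (v∈ms , v∈m) → chord-interior sc v∈m (from-x (there (∈-++⁺ˡ v∈ms))))
                (nonempty-by ms m not-both-empty)

    -- The chord shortcuts the ear unless the piece x ms y is at most as long, and then both close a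
    -- cycle of length at most 4.
    chord-along-ear : ∀ {c us x ms y ws d m} → PathEar i q c (us ++ x ∷ ms ++ y ∷ ws) d → ShortChord x m y → ⊥
    chord-along-ear ear sc@(short , _) = no-short-cycle G g5 cycle (≤-trans ms≤m short) short
      where open AlongEar ear sc

    chord-within-ear : ∀ {c us x ws d m y} → PathEar i q c (us ++ x ∷ ws) d → ShortChord x m y → y ∈ us ++ x ∷ ws → ⊥
    chord-within-ear {c} {us} {x} {ws} {d} {y = y} ear sc y∈ with ∈-++⁻ us y∈
    ... | inj₁ y∈us with ∈-∃++ y∈us
    ...   | us₁ , ms , refl =
      chord-along-ear (subst (λ r → PathEar i q c r d) (++-assoc us₁ (y ∷ ms) (x ∷ ws)) ear) (ShortChord-reverse sc)
    chord-within-ear ear sc y∈ | inj₂ (here refl) = chord-ends-distinct sc refl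
    chord-within-ear ear sc y∈ | inj₂ (there y∈ws) with ∈-∃++ y∈ws
    ...   | ms , ws′ , refl = chord-along-ear ear sc

    chord-from-ear : ∀ {x m y} → ShortChord x m y → ¬ VH i q x → VH i (suc q) x → VH i (suc q) y → ⊥
    chord-from-ear sc x∉H x∈H′ y∈H′ with path-ear (s≤s z≤n) i≤t 1≤q q<ℓ
    ... | c , rm , d , ear with ∈-∃++ (ear-interior ear x∉H x∈H′)
    ... | us , ws , refl =
      ⊥-by-cases (chord-from-ear-to-old ear sc) (λ y∉H → chord-within-ear ear sc (ear-interior ear y∉H y∈H′))

  no-chord-suc : ∀ {q} → 1 ≤ q → suc q ≤ j₀ → NoChord q → NoChord (suc q)
  no-chord-suc 1≤q q<j₀ previous sc x∈H′ y∈H′ = ⊥-by-cases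
    (λ x∈H → ⊥-by-cases (previous sc x∈H) (λ y∉H → chord-from-ear (ShortChord-reverse sc) y∉H y∈H′ x∈H′))
    (λ x∉H → chord-from-ear sc x∉H x∈H′ y∈H′)
    where open PathStage 1≤q q<j₀

  H′ : SubG n
  H′ = Hs i′ (ℓ i′)

  W′ : Fin n → Set
  W′ = Outside i′ (ℓ i′)

  C : List (Fin n)
  C = P i 1

  Meets : Set
  Meets = ∃[ xs ] (IsCycle G W′ xs × MeetsOnce H′ xs)

  H₁⊆B : ∀ {v} → VH i 1 v → VH i j₀ v
  H₁⊆B = VH-mono (same 1≤j₀)

  H′⊆H₁ : ∀ {v} → V H′ v → VH i 1 v
  H′⊆H₁ = VH-mono (earlier ≤-refl)

  EH′⊆EH₁ : ∀ {a b} → E H′ a b → EH i 1 a b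
  EH′⊆EH₁ = EH-mono (earlier ≤-refl)

  H′⊆B : ∀ {v} → V H′ v → VH i j₀ v
  H′⊆B = H₁⊆B ∘ H′⊆H₁

  C-before : Before i 1 i 1
  C-before = Before-self (s≤s z≤n) ≤-refl (≤-trans (s≤s z≤n) j₀<ℓ)

  C⊆H₁ : ∀ {v} → v ∈ C → VH i 1 v
  C⊆H₁ v∈C = i , 1 , C-before , v∈C

  C-edge⊆H₁ : ∀ {a b} → CycleEdge C a b → EH i 1 a b
  C-edge⊆H₁ e = i , 1 , C-before , e

  chord-at-previous : ∀ {x m y} → ShortChord x m y → Segment G W′ H′ x m y
  chord-at-previous (_ , chord) =
    Segment-mono G (λ ∉Z → ∉Z ∘ Z-up (s≤s z≤n) i≤t ≤-refl 1≤j₀ j₀≤ℓ ∘ Z-step-cycle i≤t) H′⊆B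
      (EH-mono (same 1≤j₀) ∘ EH′⊆EH₁) chord

  chord-interior∉H′ : ∀ {x m y v} → ShortChord x m y → v ∈ m → ¬ V H′ v
  chord-interior∉H′ sc v∈m = chord-interior sc v∈m ∘ H′⊆B

  no-chord-previous : ∀ {x m y} → ShortChord x m y → V H′ x → V H′ y → ⊥
  no-chord-previous sc x∈H′ y∈H′ = condA i′ i≤t _ (Segment⇒IsHPath G (chord-at-previous sc) x∈H′ y∈H′)

  chord-theta : ∀ {x m y} → IsCycle G W′ C → x ∈ C → y ∈ C → ShortChord x m y → Theta G W′ C x y m
  chord-theta {x} {m} {y} cyc x∈C y∈C sc@(short , _) =
    theta G cyc x∈C y∈C short (chord-at-previous sc)
      (λ v∈m v∈C → chord-interior sc v∈m (H₁⊆B (C⊆H₁ v∈C)))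
      (λ m≡[] e → chord-edge (subst (λ m′ → ShortChord x m′ y) m≡[] sc) (EH-mono (same 1≤j₀) (C-edge⊆H₁ e)))

  module _ {x m y} (sc : ShortChord x m y) (y∈H′ : V H′ y) (x∉H′ : ¬ V H′ x) where

    chord-extension-not-HPath : ∀ {mid f} → Segment G W′ H′ x mid f → V H′ f → y ≢ f →
                                All (VH i j₀) (mid ++ [ f ]) → ⊥
    chord-extension-not-HPath {mid} {f} N f∈H′ y≢f N⊆B =
      condA i′ i≤t _ (Segment⇒IsHPath G
        (Segment-join G (Segment-reverse G (proj₁ sc) (chord-at-previous sc)) N x∉H′ disjoint) y∈H′ f∈H′)
      where
      disjoint : Disjoint (y ∷ m) (mid ++ [ f ])
      disjoint (here refl , v∈) with ∈-++⁻ mid v∈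
      ... | inj₁ y∈mid       = All.lookup (interior∉H N) y∈mid y∈H′
      ... | inj₂ (here refl) = y≢f refl
      disjoint (there v∈m , v∈) = chord-interior sc v∈m (All.lookup N⊆B v∈)

    chord-extension-Meets : ∀ {mid} → Segment G W′ H′ x mid y → All (VH i j₀) mid → (mid ≡ [] → EH i j₀ x y) → Meets
    chord-extension-Meets {mid} N N⊆B edge =
      y ∷ m ++ x ∷ mid ,
      Segment⇒IsCycle G (Segment-reverse G (proj₁ sc) (chord-at-previous sc)) N
        (λ (v∈m , v∈mid) → chord-interior sc v∈m (All.lookup N⊆B v∈mid))
        (nonempty-by m mid λ m≡[] mid≡[] → chord-edge (subst (λ m′ → ShortChord x m′ y) m≡[] sc) (edge mid≡[])) ,
      y , here refl , y∈H′ , only-y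
      where
      only-y : ∀ z → z ∈ y ∷ m ++ x ∷ mid → V H′ z → z ≡ y
      only-y z (here refl) _ = refl
      only-y z (there z∈) z∈H′ with ∈-++⁻ m z∈
      ... | inj₁ z∈m           = ⊥-elim (chord-interior∉H′ sc z∈m z∈H′)
      ... | inj₂ (here refl)   = ⊥-elim (x∉H′ z∈H′)
      ... | inj₂ (there z∈mid) = ⊥-elim (All.lookup (interior∉H N) z∈mid z∈H′)

  module Type1 (C-cycle : IsCycle G W′ C) {v} (v∈C : v ∈ C) (v∈H′ : V H′ v)
               (only-v : ∀ w → w ∈ C → V H′ w → w ≡ v)
               (C-shortest : ∀ ys → IsCycle G W′ ys → MeetsOnce H′ ys → length C ≤ length ys) where

    meets-at-v : ∀ {K m} → (∀ {w} → w ∈ K → w ∈ C ⊎ w ∈ m) → (∀ {w} → w ∈ m → ¬ V H′ w) → v ∈ K →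
                 MeetsOnce H′ K
    meets-at-v K⊆ m∉H′ v∈K =
      v , v∈K , v∈H′ , λ w w∈K w∈H′ → [ (λ w∈C → only-v w w∈C w∈H′) , (λ w∈m → ⊥-elim (m∉H′ w∈m w∈H′)) ]′ (K⊆ w∈K)

    module _ {x m y} (sc : ShortChord x m y) (x∉H′ : ¬ V H′ x) (θ : Theta G W′ C x y m) where
      open Theta θ

      on-cycle₁ : v ∈ x ∷ ms ++ y ∷ m → ⊥
      on-cycle₁ v∈ = C≰cycle₁ G g5 θ (C-shortest _ cycle₁ (meets-at-v cycle₁-⊆ (chord-interior∉H′ sc) v∈))

      on-cycle₂ : v ∈ y ∷ ws ++ x ∷ m → ⊥
      on-cycle₂ v∈ = C≰cycle₂ G g5 θ (C-shortest _ cycle₂ (meets-at-v cycle₂-⊆ (chord-interior∉H′ sc) v∈))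

      theta-impossible : ⊥
      theta-impossible with ∈-arcs v∈C
      ... | inj₁ v≡x              = x∉H′ (subst (V H′) v≡x v∈H′)
      ... | inj₂ (inj₁ v≡y)       = on-cycle₁ (subst (_∈ x ∷ ms ++ y ∷ m) (sym v≡y) (there (∈-++⁺ʳ ms (here refl))))
      ... | inj₂ (inj₂ (inj₁ v∈)) = on-cycle₁ (there (∈-++⁺ˡ v∈))
      ... | inj₂ (inj₂ (inj₂ v∈)) = on-cycle₂ (there (∈-++⁺ˡ v∈))

    chord-from-C : ∀ {x m y} → ShortChord x m y → ¬ V H′ x → x ∈ C → VH i 1 y → ⊥
    chord-from-C {x} {m} {y} sc x∉H′ x∈C y∈H₁ = ⊥-by-cases
      (λ y∈C → theta-impossible sc x∉H′ (chord-theta C-cycle x∈C y∈C sc))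
      (λ y∉C → [ to-v y∉C , y∉C ]′ (VH-first⁻ y∈H₁))
      where
      x≢v : x ≢ v
      x≢v x≡v = x∉H′ (subst (V H′) (sym x≡v) v∈H′)
      open Arcs (arcs-between G C-cycle x∈C v∈C x≢v)
      x∷ms∉H′ : All (λ z → ¬ V H′ z) (x ∷ ms)
      x∷ms∉H′ = All.tabulate λ {z} z∈ z∈H′ →
        proj₂ (proj₂ (Unique-++⁻ (x ∷ ms) (unique arc₁))) (subst (_∈ x ∷ ms) (only-v z (on-C z∈) z∈H′) z∈ , here refl)
        where
        on-C : ∀ {z} → z ∈ x ∷ ms → z ∈ C
        on-C (here refl) = x∈C
        on-C (there z∈ms) = arcs-⊆ (there (∈-++⁺ˡ z∈ms))
      arc-end⊆C : ∀ {z} → z ∈ ms ++ [ v ] → z ∈ C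
      arc-end⊆C z∈ with ∈-++⁻ ms z∈
      ... | inj₁ z∈ms        = arcs-⊆ (there (∈-++⁺ˡ z∈ms))
      ... | inj₂ (here refl) = v∈C
      to-v : y ∉ C → V H′ y → ⊥
      to-v y∉C y∈H′ = chord-extension-not-HPath sc y∈H′ x∉H′
        (Segment-lift-from-outside G EH-onVertices x∷ms∉H′ arc₁) v∈H′ (λ y≡v → y∉C (subst (_∈ C) (sym y≡v) v∈C))
        (All.tabulate (H₁⊆B ∘ C⊆H₁ ∘ arc-end⊆C))

  module Type2 (¬meets : ¬ Meets) (C-cycle : IsCycle G W′ C)
               (C-shortest : ∀ ys → IsCycle G W′ ys → length C ≤ length ys) where

    C∩H′=∅ : ∀ {x w} → x ∈ C → ¬ V H′ x → w ∈ C → ¬ V H′ w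
    C∩H′=∅ x∈C x∉H′ w∈C w∈H′ = cycle-meets-once-or-HPath G EH-onVertices C-cycle x∈C x∉H′ w∈C w∈H′
      [ (λ once → ¬meets (C , C-cycle , once)) , (λ (_ , hp) → condA i′ i≤t _ hp) ]′

    theta-impossible : ∀ {x m y} → Theta G W′ C x y m → ⊥
    theta-impossible θ = C≰cycle₁ G g5 θ (C-shortest _ (Theta.cycle₁ θ))

    module _ {x m y} (sc : ShortChord x m y) (x∉H′ : ¬ V H′ x) (x∈C : x ∈ C) (y∈H′ : V H′ y) where

      closing-segment : ∀ {mid f} → Segment G W′ H′ x mid f → V H′ f → All (VH i j₀) (mid ++ [ f ]) →
                        (mid ≡ [] → EH i j₀ x f) → ⊥
      closing-segment {mid} {f} N f∈H′ N⊆B edge = ⊥-by-cases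
        (λ y≡f → ¬meets (chord-extension-Meets sc y∈H′ x∉H′ (subst (Segment G W′ H′ x mid) (sym y≡f) N)
                           (All.++⁻ˡ mid N⊆B) (subst (EH i j₀ x) (sym y≡f) ∘ edge)))
        (λ y≢f → chord-extension-not-HPath sc y∈H′ x∉H′ N f∈H′ y≢f N⊆B)

      via-second-ear : ∀ {e rm f} → Segment G W′ (Hs i 1) e rm f → e ∈ C → V H′ f →
                       All (VH i j₀) (e ∷ rm ++ [ f ]) → (rm ≡ [] → EH i j₀ e f) → ⊥
      via-second-ear {e} {rm} {f} R e∈C f∈H′ R⊆B R-edge = ⊥-by-cases from-x via-arc
        where
        R′ : Segment G W′ H′ e rm f
        R′ = Segment-mono G (λ w → w) H′⊆H₁ EH′⊆EH₁ R
        from-x : x ≡ e → ⊥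
        from-x x≡e = closing-segment (subst (λ z → Segment G W′ H′ z rm f) (sym x≡e) R′) f∈H′ (All.tail R⊆B)
                       (subst (λ z → EH i j₀ z f) (sym x≡e) ∘ R-edge)
        via-arc : x ≢ e → ⊥
        via-arc x≢e = closing-segment (Segment-join G arc R′ (C∩H′=∅ x∈C x∉H′ e∈C) disjoint) f∈H′
                        (All.++⁺ (All.++⁺ (All.tabulate (H₁⊆B ∘ C⊆H₁ ∘ x∷ms⊆C ∘ there)) (All.++⁻ˡ (e ∷ rm) R⊆B))
                                 (All.++⁻ʳ (e ∷ rm) R⊆B))
                        (λ mid≡[] → case ++-conicalʳ ms (e ∷ rm) mid≡[] of λ ())
          where
          open Arcs (arcs-between G C-cycle x∈C e∈C x≢e)
          x∷ms⊆C : ∀ {z} → z ∈ x ∷ ms → z ∈ C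
          x∷ms⊆C (here refl) = x∈C
          x∷ms⊆C (there z∈)  = arcs-⊆ (there (∈-++⁺ˡ z∈))
          arc : Segment G W′ H′ x ms e
          arc = Segment-lift-from-outside G EH-onVertices (All.tabulate (C∩H′=∅ x∈C x∉H′ ∘ x∷ms⊆C)) arc₁
          disjoint : Disjoint (x ∷ ms) (rm ++ [ f ])
          disjoint (z∈ , z∈′) with ∈-++⁻ rm z∈′
          ... | inj₁ z∈rm        = All.lookup (interior∉H R) z∈rm (C⊆H₁ (x∷ms⊆C z∈))
          ... | inj₂ (here refl) = C∩H′=∅ x∈C x∉H′ (x∷ms⊆C z∈) f∈H′

      -- The chord is also an H_{i,1}-path, so the shortest such path P i 2 has length at most 2.
      chord-to-H′ : ⊥
      chord-to-H′ with path-ear (s≤s z≤n) i≤t (s≤s z≤n) (≤-trans (s≤s 1≤j₀) j₀<ℓ)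
      ... | c , rm , d , ear = ends (VH-first⁻ c∈H) (VH-first⁻ d∈H)
        where
        open PathEar ear
        rm≤1 : length rm ≤ 1
        rm≤1 = ≤-trans (snoc-shorter {as = rm} {m} (shortest _ chord-HPath)) (proj₁ sc)
          where chord-HPath = Segment⇒IsHPath G (chord-at (s≤s z≤n) 1≤j₀ sc) (C⊆H₁ x∈C) (H′⊆H₁ y∈H′)
        R : Segment G W′ (Hs i 1) c rm d
        R = Segment-mono G (λ ∉Z → ∉Z ∘ Z-step-cycle i≤t) (λ v∈ → v∈) (λ e → e) segment
        R⊆B : ∀ {v} → v ∈ c ∷ rm ++ [ d ] → VH i j₀ v
        R⊆B = VH-mono (same 2≤j₀) ∘ on-ear
        first-edge : rm ≡ [] → Consec (c ∷ rm ++ [ d ]) c d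
        first-edge rm≡[] = subst (λ r → Consec (c ∷ r ++ [ d ]) c d) (sym rm≡[]) (inj₁ (refl , refl))
        R-edge : rm ≡ [] → EH i j₀ c d
        R-edge = EH-mono (same 2≤j₀) ∘ edge-of-ear c d ∘ first-edge
        ends : V H′ c ⊎ c ∈ C → V H′ d ⊎ d ∈ C → ⊥
        ends (inj₁ c∈H′) (inj₁ d∈H′) =
          condA i′ i≤t _ (Segment⇒IsHPath G (Segment-mono G (λ w → w) H′⊆H₁ EH′⊆EH₁ R) c∈H′ d∈H′)
        ends (inj₂ c∈C) (inj₂ d∈C) = theta-impossible (theta G C-cycle c∈C d∈C rm≤1 R
          (λ v∈rm v∈C → All.lookup (interior∉H R) v∈rm (C⊆H₁ v∈C))
          (λ rm≡[] e → proj₁ (edges∉H R c d (first-edge rm≡[])) (C-edge⊆H₁ e)))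
        ends (inj₂ c∈C) (inj₁ d∈H′) = via-second-ear R c∈C d∈H′ (All.tabulate R⊆B) R-edge
        ends (inj₁ c∈H′) (inj₂ d∈C) =
          via-second-ear (Segment-reverse G rm≤1 R) d∈C c∈H′ (All.tabulate (R⊆B ∘ ∈-swap-ends rm)) (EH-sym ∘ R-edge)

    chord-from-C : ∀ {x m y} → ShortChord x m y → ¬ V H′ x → x ∈ C → VH i 1 y → ⊥
    chord-from-C sc x∉H′ x∈C y∈H₁ = ⊥-by-cases
      (λ y∈C → theta-impossible (chord-theta C-cycle x∈C y∈C sc))
      (λ y∉C → [ chord-to-H′ sc x∉H′ x∈C , y∉C ]′ (VH-first⁻ y∈H₁))

  chord-from-cycle-ear : ∀ {x m y} → ShortChord x m y → ¬ V H′ x → x ∈ C → VH i 1 y → ⊥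
  chord-from-cycle-ear sc x∉H′ x∈C y∈H₁ = ⊥-by-cases
    (λ meets → let (C-cycle , (_ , v∈C , v∈H′ , only-v) , C-shortest) = proj₁ (condB i′ i≤t) meets
               in Type1.chord-from-C C-cycle v∈C v∈H′ only-v C-shortest sc x∉H′ x∈C y∈H₁)
    (λ ¬meets → let (C-cycle , C-shortest) = proj₂ (condB i′ i≤t) ¬meets
                in Type2.chord-from-C ¬meets C-cycle C-shortest sc x∉H′ x∈C y∈H₁)

  chord-leaving-H′ : ∀ {x m y} → ShortChord x m y → ¬ V H′ x → VH i 1 x → VH i 1 y → ⊥
  chord-leaving-H′ sc x∉H′ x∈H₁ y∈H₁ = [ x∉H′ , (λ x∈C → chord-from-cycle-ear sc x∉H′ x∈C y∈H₁) ]′ (VH-first⁻ x∈H₁)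

  no-chord-first : NoChord 1
  no-chord-first sc x∈H₁ y∈H₁ = ⊥-by-cases
    (λ x∈H′ → ⊥-by-cases (no-chord-previous sc x∈H′)
                (λ y∉H′ → chord-leaving-H′ (ShortChord-reverse sc) y∉H′ y∈H₁ x∈H₁))
    (λ x∉H′ → chord-leaving-H′ sc x∉H′ x∈H₁ y∈H₁)

  no-chord : ∀ q → 1 ≤ q → q ≤ j₀ → NoChord q
  no-chord (suc zero)    _ _    = no-chord-first
  no-chord (suc (suc q)) _ q<j₀ = no-chord-suc (s≤s z≤n) q<j₀ (no-chord (suc q) (s≤s z≤n) (<⇒≤ q<j₀))

lemma3p6 : ∀ {n} (G : Graph n) → Girth≥5 G →
    (t : ℕ) (ℓ : ℕ → ℕ) (P : ℕ → ℕ → List (Fin n)) →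
    Ears.CoarseEar G ℓ P t →
    ∀ i j → 1 ≤ i → i ≤ t → 1 ≤ j → j ≤ ℓ i →
    Ears.earLength G ℓ P j (P i j) ≤ 2 → j ≡ 2
lemma3p6 G g5 t ℓ P ce i        zero                _ _   () _ _
lemma3p6 G g5 t ℓ P ce zero     (suc _)             () _ _ _ _
lemma3p6 G g5 t ℓ P ce (suc i′) (suc zero)          _ i≤t _ _ short =
  ⊥-elim (Decomposition.first-ear-isCycle G t ℓ P ce i′ i≤t λ cycle →
            case ≤-trans (girth≥5 G g5 cycle) short of λ { (s≤s (s≤s ())) })
lemma3p6 G g5 t ℓ P ce i        (suc (suc zero))    _ _ _ _ _ = refl
lemma3p6 G g5 t ℓ P ce (suc i′) (suc (suc (suc j))) _ i≤t _ j<ℓ short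
  with Decomposition.path-ear G t ℓ P ce (s≤s z≤n) i≤t (s≤s z≤n) j<ℓ
... | c , rm , d , ear = ⊥-elim (no-chord j₀ (s≤s z≤n) ≤-refl (rm≤1 , segment) c∈H d∈H)
  where
  j₀ = suc (suc j)
  open ShortChords G g5 t ℓ P ce i′ j₀ i≤t (s≤s (s≤s z≤n)) j<ℓ
  open Decomposition.PathEar ear
  rm≤1 : length rm ≤ 1
  rm≤1 = +-cancelʳ-≤ 1 (length rm) 1 (subst (_≤ 2) (trans (cong pathLength shape) (length-++ rm)) short)
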